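{- For any integers $k,n$ with $k>n\geq2$, $$\sum_{\substack{l+k_1+\cdots+k_{n-1}=k\\ l,k_i\geq1,\ k_1\geq2}}z_l\ast_t z_{k_1}\cdots z_{k_{n-1}}=n\sum_{\mathbf{k}\in I^0_{k,n}}z_{\mathbf{k}}+\sum_{\substack{\mathbf{k}\in I_{k,n}\\ k_1=1}}z_{\mathbf{k}}-\sum_{\substack{\mathbf{k}\in I_{k,n}\\ k_2=1}}z_{\mathbf{k}}+(1-2t)(k-n)\sum_{\mathbf{k}\in I^0_{k,n-1}}z_{\mathbf{k}}+(t^2-t)\sum_{\mathbf{k}\in I^0_{k,n-2}}b_{\mathbf{k}}z_{\mathbf{k}}.$$
   Context: Let $\mathfrak{h}_t=\mathbb{Q}[t]\langle x,y\rangle$ ($t$ a variable) be the noncommutative polynomial algebra in letters $x,y$, $\mathfrak{h}_t^1=\mathbb{Q}[t]+\mathfrak{h}_ty$, $z_k=x^{k-1}y$. The $t$-harmonic product $\ast_t$ on $\mathfrak{h}_t^1$ is $\mathbb{Q}[t]$-bilinear with $1\ast_tw=w\ast_t1=w$ and $z_kw_1\ast_t z_lw_2=z_k(w_1\ast_t z_lw_2)+z_l(z_kw_1\ast_t w_2)+(1-2t)z_{k+l}(w_1\ast_t w_2)+[1-\delta(w_1)\delta(w_2)](t^2-t)x^{k+l}(w_1\ast_t w_2)$ for words $w_1,w_2\in\mathfrak{h}_t^1$, $k,l\ge1$, where $\delta(w)=1$ if $w=1$, else $0$. $I_{k,n}$ is the set of indices $\mathbf{k}=(k_1,\ldots,k_n)$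 of positive integers with $k_1+\cdots+k_n=k$; $I^0_{k,n}$ the subset with $k_1\geq2$; $z_{\mathbf{k}}=z_{k_1}\cdots z_{k_n}$. $I^0_{k,n-2}=\varnothing$ when $n=2$; for $n>2$ and $\mathbf{k}\in I^0_{k,n-2}$, $b_{\mathbf{k}}=\binom{k_1-2}{2}+\binom{k_2-1}{2}+\cdots+\binom{k_{n-2}-1}{2}$. -}

module Defs where

open import Data.Nat as ℕ using (ℕ; zero; suc; _∸_; _≤ᵇ_)
open import Data.Nat.Combinatorics using (_C_)
open import Data.Nat.ListAction using (sum)
open import Data.Bool using (Bool; true; false; if_then_else_; _∧_)
open import Data.List as L using (List; []; _∷_; _++_; replicate; map; concatMap; filter; upTo)
open import Data.Product using (_×_; _,_)
open import Data.Rational as Q using (ℚ; 0ℚ; 1ℚ; normalize)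
open import Relation.Binary.PropositionalEquality using (_≡_)
open import Relation.Nullary using (Dec; yes; no; does)
open import Data.List.Properties using (≡-dec)

data Letter : Set where
  x y : Letter

_≟L_ : (a b : Letter) → Dec (a ≡ b)
x ≟L x = yes _≡_.refl
x ≟L y = no (λ ())
y ≟L x = no (λ ())
y ≟L y = yes _≡_.refl

Word : Set
Word = List Letter

_≟W_ : (u v : Word) → Dec (u ≡ v)
_≟W_ = ≡-dec _≟L_

-- z_k = x^{k-1} y  (used only for k ≥ 1)
zL : ℕ → Word
zL k = replicate (k ∸ 1) x ++ (y ∷ [])

zW : List ℕ → Word
zW = concatMap zL

-- Elements of 𝔥_t = ℚ[t]⟨x,y⟩ as finite formal sums of terms c · t^d · w

Term : Set
Term = ℚ × ℕ × Word

H : Set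
H = List Term

coeff : H → ℕ → Word → ℚ
coeff [] d w = 0ℚ
coeff ((c , e , u) ∷ a) d w with does (e ℕ.≟ d) ∧ does (u ≟W w)
... | true  = c Q.+ coeff a d w
... | false = coeff a d w

infix 4 _≈_
_≈_ : H → H → Set
a ≈ b = ∀ (d : ℕ) (w : Word) → coeff a d w ≡ coeff b d w

fromℕ : ℕ → ℚ
fromℕ n = normalize n 1

infixl 6 _⊕_ _⊖_
_⊕_ : H → H → H
_⊕_ = _++_

neg : H → H
neg = map (λ { (c , e , u) → (Q.- c , e , u) })

_⊖_ : H → H → H
a ⊖ b = a ++ neg b

mono : Word → H
mono w = (1ℚ , 0 , w) ∷ []

lmul : Word → H → H
lmul v = map (λ { (c , e , u) → (c , e , v ++ u) })

smul : List (ℚ × ℕ) → H → H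
smul p a = concatMap (λ { (c , e) → map (λ { (c' , e' , u) → (c Q.* c' , e ℕ.+ e' , u) }) a }) p

qmul : ℚ → H → H
qmul q = smul ((q , 0) ∷ [])

oneMinus2t : List (ℚ × ℕ)
oneMinus2t = (1ℚ , 0) ∷ (Q.- fromℕ 2 , 1) ∷ []

t²-t : List (ℚ × ℕ)
t²-t = (1ℚ , 2) ∷ (Q.- 1ℚ , 1) ∷ []

hsum : List H → H
hsum = L.foldr _⊕_ []

-- t-harmonic product on words of 𝔥_t^1, a word z_{k_1}⋯z_{k_n} being
-- represented by its index list (k_1,…,k_n) (all k_i ≥ 1).

isEmpty : List ℕ → Bool
isEmpty [] = true
isEmpty (_ ∷ _) = false

notBothEmpty : List ℕ → List ℕ → Bool
notBothEmpty w1 w2 = if isEmpty w1 ∧ isEmpty w2 then false else true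

-- helper: given k, w1 and the function (w1 ∗_t -), compute (z_k w1 ∗_t -)
harmAux : ℕ → List ℕ → (List ℕ → H) → List ℕ → H
harmAux k w1 f [] = mono (zW (k ∷ w1))
harmAux k w1 f (l ∷ w2) =
  lmul (zL k) (f (l ∷ w2))
  ⊕ lmul (zL l) (harmAux k w1 f w2)
  ⊕ smul oneMinus2t (lmul (zL (k ℕ.+ l)) (f w2))
  ⊕ (if notBothEmpty w1 w2
       then smul t²-t (lmul (replicate (k ℕ.+ l) x) (f w2))
       else [])

infixl 7 _∗t_
_∗t_ : List ℕ → List ℕ → H
[] ∗t w2 = mono (zW w2)
(k ∷ w1) ∗t w2 = harmAux k w1 (w1 ∗t_) w2

comps : ℕ → ℕ → List (List ℕ)
comps zero zero = [] ∷ []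
comps (suc _) zero = []
comps k (suc n) = concatMap (λ a → map (a ∷_) (comps (k ∸ a) n)) (map suc (upTo k))

firstAtLeast2 : List ℕ → Bool
firstAtLeast2 [] = false
firstAtLeast2 (a ∷ _) = 2 ≤ᵇ a

firstIs1 : List ℕ → Bool
firstIs1 (1 ∷ _) = true
firstIs1 _ = false

secondIs1 : List ℕ → Bool
secondIs1 (_ ∷ 1 ∷ _) = true
secondIs1 _ = false

filterB : (List ℕ → Bool) → List (List ℕ) → List (List ℕ)
filterB p [] = []
filterB p (a ∷ as) = if p a then a ∷ filterB p as else filterB p as

comps0 : ℕ → ℕ → List (List ℕ)
comps0 k n = filterB firstAtLeast2 (comps k n)

b : List ℕ → ℕ
b [] = 0
b (k₁ ∷ ks) = ((k₁ ∸ 2) C 2) ℕ.+ sum (map (λ kᵢ → (kᵢ ∸ 1) C 2) ks)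

sumZ : List (List ℕ) → H
sumZ S = hsum (map (λ ks → mono (zW ks)) S)

LHS : ℕ → ℕ → H
LHS k n = hsum (concatMap
  (λ l → map (λ ks → (l ∷ []) ∗t ks) (comps0 (k ∸ l) (n ∸ 1)))
  (map suc (upTo k)))

RHS : ℕ → ℕ → H
RHS k n =
  qmul (fromℕ n) (sumZ (comps0 k n))
  ⊕ sumZ (filterB firstIs1 (comps k n))
  ⊖ sumZ (filterB secondIs1 (comps k n))
  ⊕ smul oneMinus2t (qmul (fromℕ (k ∸ n)) (sumZ (comps0 k (n ∸ 1))))
  ⊕ smul t²-t (hsum (map (λ ks → qmul (fromℕ (b ks)) (mono (zW ks))) (comps0 k (n ∸ 2))))

{-# OPTIONS --safe #-}
-- Expanding z_l ∗_t z_a w by the defining recursion gives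
--   z_l z_a w + z_a (z_l ∗_t w) + (1 − 2t) z_{l+a} w + (t² − t) x^{l+a} z_w   (last term only for w ≠ ∅).
-- Sum over l, a ≥ 1 and w with l + a + |w| = k, weighted by [a > r]. The second term is z_a times the sum of one length
-- less, the third is a sum of words z_c w' counted c − r − 1 times (c = l + a), and the last, as
-- x^{l+a} z_b = z_{l+a+b}, a sum of words z_c w' counted C(c − r − 1, 2) times. For r = 0 this yields by
-- induction on the length m
--   Σ_{l ≥ 1, w ∈ I_{k−l,m}} z_l ∗_t z_w
--     = (m + 1) Σ_{I_{k,m+1}} z + (1 − 2t)(k − m) Σ_{I_{k,m}} z + (t² − t) Σ_{w ∈ I_{k,m−1}} β(w) z_w,
-- with β(w) = Σ_i C(w_i − 1, 2). The theorem is the case r = 1 with n = m + 2: there the words z_l z_a w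
-- are those of I_{k,n} with k₂ ≥ 2, so after adding the words with k₂ = 1 to both sides it remains to
-- split Σ_{I_{k,n}} z according to k₁ ≥ 2 or k₁ = 1.

module Submission where

open import Defs
open import Algebra.Bundles using (CommutativeMonoid)
open import Data.Bool using (Bool; true; false; if_then_else_; _∧_; T)
open import Data.Bool.Properties using (∧-zeroʳ)
open import Data.List as L using (List; []; _∷_; _++_; replicate; map; concatMap; upTo)
import Data.List.Properties as List
open import Data.Nat as ℕ using (ℕ; zero; suc; _∸_; _<ᵇ_; z≤n; s≤s; _<_; _≤_)
open import Data.Nat.ListAction using (sum)
import Data.Nat.Properties as ℕ
open import Data.Nat.Combinatorics using (_C_; nC1≡n; nCk+nC[k+1]≡[n+1]C[k+1])
open import Data.Product as Product using (_,_; ∃; ∃₂)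
open import Data.Empty using (⊥-elim)
open import Data.Rational as ℚ using (ℚ; 0ℚ; 1ℚ; mkℚ)
import Data.Rational.Properties as ℚ
open import Data.Rational.Unnormalised as ℚᵘ using (*≡*)
import Data.Rational.Unnormalised.Properties as ℚᵘ
open import Data.Integer as ℤ using (+_)
import Data.Integer.Properties as ℤ
open import Data.Nat.Coprimality using (1-coprimeTo) renaming (sym to coprime-sym)
open import Algebra.Morphism.Structures using (module MonoidMorphisms)
import Algebra.Morphism.Construct.Composition as Composition
open import Relation.Binary.PropositionalEquality using (_≡_; refl; sym; trans; cong; cong₂; subst; module ≡-Reasoning)
open import Relation.Nullary using (Dec; yes; no; does; ¬_)
open import Relation.Nullary.Decidable using (dec-true; dec-false)

𝟙 : Bool → ℕ
𝟙 true  = 1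
𝟙 false = 0

above : ℕ → ℕ → ℕ
above r a = 𝟙 (r <ᵇ a)

above-< : ∀ {r a} → r < a → above r a ≡ 1
above-< {zero}  {suc a} _         = refl
above-< {suc r} {suc a} (s≤s r<a) = above-< r<a

above-≤ : ∀ {r a} → a ≤ r → above r a ≡ 0
above-≤ {r}     {zero}  _         = refl
above-≤ {suc r} {suc a} (s≤s a≤r) = above-≤ a≤r

sumTo : ℕ → (ℕ → ℕ) → ℕ
sumTo zero    h = 0
sumTo (suc n) h = sumTo n h ℕ.+ h (suc n)

sumTo-above : ∀ r n → sumTo n (above r) ≡ n ∸ r
sumTo-above r zero    = sym (ℕ.0∸n≡0 r)
sumTo-above r (suc n) with r ℕ.≤? n
... | yes r≤n = begin
  sumTo n (above r) ℕ.+ above r (suc n) ≡⟨ cong₂ ℕ._+_ (sumTo-above r n) (above-< (s≤s r≤n)) ⟩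
  n ∸ r ℕ.+ 1                           ≡⟨ ℕ.+-comm (n ∸ r) 1 ⟩
  suc (n ∸ r)                           ≡⟨ ℕ.+-∸-assoc 1 r≤n ⟨
  suc n ∸ r                             ∎
  where open ≡-Reasoning
... | no r≰n = begin
  sumTo n (above r) ℕ.+ above r (suc n) ≡⟨ cong₂ ℕ._+_ (sumTo-above r n) (above-≤ (ℕ.≰⇒> r≰n)) ⟩
  n ∸ r ℕ.+ 0                           ≡⟨ cong (ℕ._+ 0) (ℕ.m≤n⇒m∸n≡0 (ℕ.<⇒≤ (ℕ.≰⇒> r≰n))) ⟩
  0                                     ≡⟨ ℕ.m≤n⇒m∸n≡0 (ℕ.≰⇒> r≰n) ⟨
  suc n ∸ r                             ∎
  where open ≡-Reasoning

sumTo-∸ : ∀ r n → sumTo n (λ j → j ∸ suc r) ≡ (n ∸ r) C 2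
sumTo-∸ r zero    = cong (_C 2) (sym (ℕ.0∸n≡0 r))
sumTo-∸ r (suc n) with r ℕ.≤? n
... | yes r≤n = begin
  sumTo n (λ j → j ∸ suc r) ℕ.+ (n ∸ r)  ≡⟨ cong (ℕ._+ (n ∸ r)) (sumTo-∸ r n) ⟩
  (n ∸ r) C 2 ℕ.+ (n ∸ r)                ≡⟨ ℕ.+-comm ((n ∸ r) C 2) (n ∸ r) ⟩
  (n ∸ r) ℕ.+ (n ∸ r) C 2                ≡⟨ cong (ℕ._+ (n ∸ r) C 2) (nC1≡n (n ∸ r)) ⟨
  (n ∸ r) C 1 ℕ.+ (n ∸ r) C 2            ≡⟨ nCk+nC[k+1]≡[n+1]C[k+1] (n ∸ r) 1 ⟩
  suc (n ∸ r) C 2                        ≡⟨ cong (_C 2) (ℕ.+-∸-assoc 1 r≤n) ⟨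
  (suc n ∸ r) C 2                        ∎
  where open ≡-Reasoning
... | no r≰n = begin
  sumTo n (λ j → j ∸ suc r) ℕ.+ (n ∸ r)  ≡⟨ cong₂ ℕ._+_ (sumTo-∸ r n) n∸r≡0 ⟩
  (n ∸ r) C 2 ℕ.+ 0                      ≡⟨ cong (λ j → j C 2 ℕ.+ 0) n∸r≡0 ⟩
  0                                      ≡⟨ cong (_C 2) (ℕ.m≤n⇒m∸n≡0 (ℕ.≰⇒> r≰n)) ⟨
  (suc n ∸ r) C 2                        ∎
  where
  open ≡-Reasoning
  n∸r≡0 : n ∸ r ≡ 0
  n∸r≡0 = ℕ.m≤n⇒m∸n≡0 (ℕ.<⇒≤ (ℕ.≰⇒> r≰n))

∸-telescope : ∀ {k i j} → j ≤ i → i ≤ k → k ∸ i ℕ.+ (i ∸ j) ≡ k ∸ j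
∸-telescope {k} {i} {j} j≤i i≤k = begin
  k ∸ i ℕ.+ (i ∸ j)   ≡⟨ ℕ.+-∸-assoc (k ∸ i) j≤i ⟨
  k ∸ i ℕ.+ i ∸ j     ≡⟨ cong (_∸ j) (ℕ.m∸n+n≡m i≤k) ⟩
  k ∸ j               ∎
  where open ≡-Reasoning

∸-merge : ∀ k c m r → r < c → c ℕ.+ m ≤ k → k ∸ c ∸ m ℕ.+ (c ∸ suc r) ≡ k ∸ (m ℕ.+ suc r)
∸-merge k c m r r<c c+m≤k = begin
  k ∸ c ∸ m ℕ.+ (c ∸ suc r)                       ≡⟨ cong₂ ℕ._+_ (ℕ.∸-+-assoc k c m) (sym (ℕ.[m+n]∸[m+o]≡n∸o m c (suc r))) ⟩
  k ∸ (c ℕ.+ m) ℕ.+ (m ℕ.+ c ∸ (m ℕ.+ suc r))    ≡⟨ cong (λ i → k ∸ i ℕ.+ (m ℕ.+ c ∸ (m ℕ.+ suc r))) (ℕ.+-comm c m) ⟩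
  k ∸ (m ℕ.+ c) ℕ.+ (m ℕ.+ c ∸ (m ℕ.+ suc r))    ≡⟨ ∸-telescope (ℕ.+-monoʳ-≤ m r<c) (subst (_≤ k) (ℕ.+-comm c m) c+m≤k) ⟩
  k ∸ (m ℕ.+ suc r)                               ∎
  where open ≡-Reasoning

∸-comm : ∀ k l a → k ∸ l ∸ a ≡ k ∸ a ∸ l
∸-comm k l a = trans (ℕ.∸-+-assoc k l a) (trans (cong (k ∸_) (ℕ.+-comm l a)) (sym (ℕ.∸-+-assoc k a l)))

above-merge : ∀ k c m r → c ℕ.+ m ≤ k → above r c ℕ.* (k ∸ c ∸ m) ℕ.+ (c ∸ suc r) ≡ (k ∸ (m ℕ.+ suc r)) ℕ.* above r c
above-merge k c m r c+m≤k with r ℕ.<? c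
... | yes r<c rewrite above-< r<c = trans (cong (ℕ._+ (c ∸ suc r)) (ℕ.*-identityˡ (k ∸ c ∸ m)))
  (trans (∸-merge k c m r r<c c+m≤k) (sym (ℕ.*-identityʳ (k ∸ (m ℕ.+ suc r)))))
... | no  r≮c rewrite above-≤ (ℕ.≮⇒≥ r≮c) =
  trans (ℕ.m≤n⇒m∸n≡0 (ℕ.m≤n⇒m≤1+n (ℕ.≮⇒≥ r≮c))) (sym (ℕ.*-zeroʳ (k ∸ (m ℕ.+ suc r))))

above-C2 : ∀ r c → above r c ℕ.* ((c ∸ suc r) C 2) ≡ (c ∸ suc r) C 2
above-C2 r c with r ℕ.<? c
... | yes r<c rewrite above-< r<c = ℕ.*-identityˡ _
... | no  r≮c rewrite above-≤ (ℕ.≮⇒≥ r≮c) | ℕ.m≤n⇒m∸n≡0 (ℕ.m≤n⇒m≤1+n (ℕ.≮⇒≥ r≮c)) = refl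

replicate-x-++-zL : ∀ n b → replicate n x ++ zL (suc b) ≡ zL (n ℕ.+ suc b)
replicate-x-++-zL n b = trans (prepend n) (cong (λ i → replicate (i ∸ 1) x ++ y ∷ []) (sym (ℕ.+-suc n b)))
  where
  prepend : ∀ n → replicate n x ++ replicate b x ++ y ∷ [] ≡ replicate (n ℕ.+ b) x ++ y ∷ []
  prepend zero    = refl
  prepend (suc n) = cong (x ∷_) (prepend n)

fromℕ≡mkℚ : ∀ n → fromℕ n ≡ mkℚ (+ n) 0 (coprime-sym (1-coprimeTo n))
fromℕ≡mkℚ n = ℚ.normalize-coprime (coprime-sym (1-coprimeTo n))

fromℕ-suc : ∀ n → fromℕ (suc n) ≡ 1ℚ ℚ.+ fromℕ n
fromℕ-suc n rewrite fromℕ≡mkℚ n | fromℕ≡mkℚ (suc n) =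
  ℚ.toℚᵘ-injective (ℚᵘ.≃-trans (*≡* numerators)
    (ℚᵘ.≃-sym (ℚ.toℚᵘ-homo-+ 1ℚ (mkℚ (+ n) 0 (coprime-sym (1-coprimeTo n))))))
  where
  numerators : + suc n ℤ.* + 1 ≡ (+ 1 ℤ.* + 1 ℤ.+ + n ℤ.* + 1) ℤ.* + 1
  numerators = trans (ℤ.*-identityʳ _)
    (sym (trans (ℤ.*-identityʳ _) (cong (ℤ._+_ (+ 1)) (ℤ.*-identityʳ (+ n)))))

-- A record around _≈_, so that both sides can be recovered from a proof.
infix 4 _≋_
record _≋_ (a b : H) : Set where
  constructor coeffwise
  field coeff-≡ : a ≈ b
open _≋_

≋-refl : ∀ {a} → a ≋ a
≋-refl = coeffwise λ _ _ → refl

≋-sym : ∀ {a b} → a ≋ b → b ≋ a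
≋-sym (coeffwise p) = coeffwise λ d w → sym (p d w)

≋-trans : ∀ {a b c} → a ≋ b → b ≋ c → a ≋ c
≋-trans (coeffwise p) (coeffwise q) = coeffwise λ d w → trans (p d w) (q d w)

≡⇒≋ : ∀ {a b} → a ≡ b → a ≋ b
≡⇒≋ refl = ≋-refl

matches : ℕ → Word → ℕ → Word → Bool
matches e u d w = does (e ℕ.≟ d) ∧ does (u ≟W w)

addIf : Bool → ℚ → ℚ → ℚ
addIf true  c r = c ℚ.+ r
addIf false c r = r

coeff-∷ : ∀ c e u a d w → coeff ((c , e , u) ∷ a) d w ≡ addIf (matches e u d w) c (coeff a d w)
coeff-∷ c e u a d w with matches e u d w
... | true  = refl
... | false = refl

addIf-+ : ∀ p c r s → addIf p c (r ℚ.+ s) ≡ addIf p c r ℚ.+ s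
addIf-+ true  c r s = sym (ℚ.+-assoc c r s)
addIf-+ false c r s = refl

coeff-++ : ∀ a a′ d w → coeff (a ++ a′) d w ≡ coeff a d w ℚ.+ coeff a′ d w
coeff-++ []                a′ d w = sym (ℚ.+-identityˡ _)
coeff-++ ((c , e , u) ∷ a) a′ d w = begin
  coeff ((c , e , u) ∷ a ++ a′) d w                            ≡⟨ coeff-∷ c e u (a ++ a′) d w ⟩
  addIf (matches e u d w) c (coeff (a ++ a′) d w)              ≡⟨ cong (addIf (matches e u d w) c) (coeff-++ a a′ d w) ⟩
  addIf (matches e u d w) c (coeff a d w ℚ.+ coeff a′ d w)     ≡⟨ addIf-+ (matches e u d w) c (coeff a d w) (coeff a′ d w) ⟩
  addIf (matches e u d w) c (coeff a d w) ℚ.+ coeff a′ d w     ≡⟨ cong (ℚ._+ coeff a′ d w) (coeff-∷ c e u a d w) ⟨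
  coeff ((c , e , u) ∷ a) d w ℚ.+ coeff a′ d w                 ∎
  where open ≡-Reasoning

⊕-cong : ∀ {a a′ b b′} → a ≋ a′ → b ≋ b′ → a ⊕ b ≋ a′ ⊕ b′
⊕-cong {a} {a′} {b} {b′} (coeffwise p) (coeffwise q) = coeffwise λ d w →
  trans (coeff-++ a b d w) (trans (cong₂ ℚ._+_ (p d w) (q d w)) (sym (coeff-++ a′ b′ d w)))

⊕-comm : ∀ a a′ → a ⊕ a′ ≋ a′ ⊕ a
⊕-comm a a′ = coeffwise λ d w →
  trans (coeff-++ a a′ d w) (trans (ℚ.+-comm (coeff a d w) (coeff a′ d w)) (sym (coeff-++ a′ a d w)))

H-commutativeMonoid : CommutativeMonoid _ _
H-commutativeMonoid = record
  { Carrier = H ; _≈_ = _≋_ ; _∙_ = _⊕_ ; ε = []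
  ; isCommutativeMonoid = record
    { isMonoid = record
      { isSemigroup = record
        { isMagma = record
          { isEquivalence = record { refl = ≋-refl ; sym = ≋-sym ; trans = ≋-trans }
          ; ∙-cong = ⊕-cong }
        ; assoc = λ a₁ a₂ a₃ → ≡⇒≋ (List.++-assoc a₁ a₂ a₃) }
      ; identity = (λ _ → ≋-refl) , (λ a → ≡⇒≋ (List.++-identityʳ a)) }
    ; comm = ⊕-comm } }

open CommutativeMonoid H-commutativeMonoid
  using (setoid; rawMonoid; commutativeSemigroup)
  renaming (assoc to ⊕-assoc; identityʳ to ⊕-identityʳ; ∙-congˡ to ⊕-congˡ; ∙-congʳ to ⊕-congʳ)
open import Algebra.Properties.CommutativeSemigroup commutativeSemigroup
  using () renaming (interchange to ⊕-interchange)
open import Algebra.Properties.CommutativeMonoid.Mult H-commutativeMonoid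
  using (_×_; ×-cong; ×-congʳ; ×-homo-1; ×-homo-+; ×-distrib-+; ×-assocˡ)
open import Algebra.Solver.CommutativeMonoid H-commutativeMonoid as ⊕-Solver using (solve; _⊜_)

⊕-cancelʳ : ∀ a a′ c → a ⊕ c ≋ a′ ⊕ c → a ≋ a′
⊕-cancelʳ a a′ c (coeffwise p) = coeffwise λ d w →
  ℚ+-cancelʳ (coeff c d w) (coeff a d w) (coeff a′ d w)
    (trans (sym (coeff-++ a c d w)) (trans (p d w) (coeff-++ a′ c d w)))
  where open import Algebra.Properties.Group ℚ.+-0-group using () renaming (∙-cancelʳ to ℚ+-cancelʳ)

record IsAdditive (κ : ℚ → ℚ) : Set where
  field
    κ-0 : κ 0ℚ ≡ 0ℚ
    κ-+ : ∀ p q → κ (p ℚ.+ q) ≡ κ p ℚ.+ κ q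
open IsAdditive

-- lmul, neg and each summand of smul are definitionally of this form.
reindex : (ℚ → ℚ) → ℕ → Word → H → H
reindex κ s v = map λ (c , e , u) → (κ c , s ℕ.+ e , v ++ u)

++-cancelˡ : ∀ (v : Word) {u w} → v ++ u ≡ v ++ w → u ≡ w
++-cancelˡ []      eq = eq
++-cancelˡ (_ ∷ v) eq = ++-cancelˡ v (List.∷-injectiveʳ eq)

≡ᵇ-+ : ∀ s e d → (s ℕ.+ e ℕ.≡ᵇ s ℕ.+ d) ≡ (e ℕ.≡ᵇ d)
≡ᵇ-+ zero    e d = refl
≡ᵇ-+ (suc s) e d = ≡ᵇ-+ s e d

≟W-++ : ∀ (v u w : Word) → does ((v ++ u) ≟W (v ++ w)) ≡ does (u ≟W w)
≟W-++ v u w with u ≟W w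
... | yes refl = dec-true ((v ++ u) ≟W (v ++ u)) refl
... | no u≢w   = dec-false ((v ++ u) ≟W (v ++ w)) (λ eq → u≢w (++-cancelˡ v eq))

addIf-additive : ∀ {κ} → IsAdditive κ → ∀ p c r → addIf p (κ c) (κ r) ≡ κ (addIf p c r)
addIf-additive κ+ true  c r = sym (κ-+ κ+ c r)
addIf-additive κ+ false c r = refl

coeff-reindex : ∀ {κ} → IsAdditive κ → ∀ s v a d w →
                coeff (reindex κ s v a) (s ℕ.+ d) (v ++ w) ≡ κ (coeff a d w)
coeff-reindex κ+ s v [] d w = sym (κ-0 κ+)
coeff-reindex {κ} κ+ s v ((c , e , u) ∷ a) d w = begin
  coeff (reindex κ s v ((c , e , u) ∷ a)) (s ℕ.+ d) (v ++ w)
    ≡⟨ coeff-∷ (κ c) (s ℕ.+ e) (v ++ u) (reindex κ s v a) (s ℕ.+ d) (v ++ w) ⟩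
  addIf (matches (s ℕ.+ e) (v ++ u) (s ℕ.+ d) (v ++ w)) (κ c) (coeff (reindex κ s v a) (s ℕ.+ d) (v ++ w))
    ≡⟨ cong₂ (λ p q → addIf (p ∧ q) (κ c) (coeff (reindex κ s v a) (s ℕ.+ d) (v ++ w))) (≡ᵇ-+ s e d) (≟W-++ v u w) ⟩
  addIf (matches e u d w) (κ c) (coeff (reindex κ s v a) (s ℕ.+ d) (v ++ w))
    ≡⟨ cong (addIf (matches e u d w) (κ c)) (coeff-reindex κ+ s v a d w) ⟩
  addIf (matches e u d w) (κ c) (κ (coeff a d w))
    ≡⟨ addIf-additive κ+ (matches e u d w) c (coeff a d w) ⟩
  κ (addIf (matches e u d w) c (coeff a d w))
    ≡⟨ cong κ (coeff-∷ c e u a d w) ⟨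
  κ (coeff ((c , e , u) ∷ a) d w) ∎
  where open ≡-Reasoning

coeff-reindex-outside : ∀ κ s v a d w → ¬ ∃₂ (λ d′ w′ → d ≡ s ℕ.+ d′ Product.× w ≡ v ++ w′) →
                        coeff (reindex κ s v a) d w ≡ 0ℚ
coeff-reindex-outside κ s v [] d w _ = refl
coeff-reindex-outside κ s v ((c , e , u) ∷ a) d w outside =
  trans (coeff-∷ (κ c) (s ℕ.+ e) (v ++ u) (reindex κ s v a) d w)
    (trans (cong (λ p → addIf p (κ c) (coeff (reindex κ s v a) d w)) no-match)
      (coeff-reindex-outside κ s v a d w outside))
  where
  no-match : does (s ℕ.+ e ℕ.≟ d) ∧ does ((v ++ u) ≟W w) ≡ false
  no-match with (v ++ u) ≟W w
  ... | no _     = ∧-zeroʳ _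
  ... | yes refl with s ℕ.+ e ℕ.≡ᵇ d in degree-match
  ...   | false = refl
  ...   | true  = ⊥-elim (outside (e , u , sym (ℕ.≡ᵇ⇒≡ _ _ (subst T (sym degree-match) _)) , refl))

prefix? : (v w : Word) → Dec (∃ λ w′ → w ≡ v ++ w′)
prefix? []      w        = yes (w , refl)
prefix? (_ ∷ _) []       = no λ ()
prefix? (l ∷ v) (l′ ∷ w) with l ≟L l′ | prefix? v w
... | yes refl | yes (w′ , refl) = yes (w′ , refl)
... | yes refl | no  ¬prefix     = no λ (w′ , eq) → ¬prefix (w′ , List.∷-injectiveʳ eq)
... | no  l≢l′ | _               = no λ (_ , eq) → l≢l′ (sym (List.∷-injectiveˡ eq))

reindex-cong : ∀ {κ} → IsAdditive κ → ∀ s v {a a′} → a ≋ a′ → reindex κ s v a ≋ reindex κ s v a′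
reindex-cong {κ} κ+ s v {a} {a′} (coeffwise a≈a′) = coeffwise coeffs
  where
  coeffs : reindex κ s v a ≈ reindex κ s v a′
  coeffs d w with s ℕ.≤? d | prefix? v w
  ... | yes s≤d | yes (w′ , refl) =
    subst (λ d → coeff (reindex κ s v a) d (v ++ w′) ≡ coeff (reindex κ s v a′) d (v ++ w′))
      (ℕ.m+[n∸m]≡n s≤d)
      (trans (coeff-reindex κ+ s v a (d ∸ s) w′)
        (trans (cong κ (a≈a′ (d ∸ s) w′)) (sym (coeff-reindex κ+ s v a′ (d ∸ s) w′))))
  ... | yes _ | no ¬prefix =
    trans (coeff-reindex-outside κ s v a d w outside) (sym (coeff-reindex-outside κ s v a′ d w outside))
    where outside = λ (_ , w′ , _ , eq) → ¬prefix (w′ , eq)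
  ... | no s≰d | _ =
    trans (coeff-reindex-outside κ s v a d w outside) (sym (coeff-reindex-outside κ s v a′ d w outside))
    where outside = λ (d′ , _ , eq , _) → s≰d (subst (s ℕ.≤_) (sym eq) (ℕ.m≤m+n s d′))

coeff-× : ∀ n a d w → coeff (n × a) d w ≡ fromℕ n ℚ.* coeff a d w
coeff-× zero    a d w = sym (ℚ.*-zeroˡ (coeff a d w))
coeff-× (suc n) a d w = begin
  coeff (a ⊕ n × a) d w                             ≡⟨ coeff-++ a (n × a) d w ⟩
  coeff a d w ℚ.+ coeff (n × a) d w                 ≡⟨ cong₂ ℚ._+_ (sym (ℚ.*-identityˡ (coeff a d w))) (coeff-× n a d w) ⟩
  1ℚ ℚ.* coeff a d w ℚ.+ fromℕ n ℚ.* coeff a d w    ≡⟨ ℚ.*-distribʳ-+ (coeff a d w) 1ℚ (fromℕ n) ⟨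
  (1ℚ ℚ.+ fromℕ n) ℚ.* coeff a d w                  ≡⟨ cong (ℚ._* coeff a d w) (fromℕ-suc n) ⟨
  fromℕ (suc n) ℚ.* coeff a d w                     ∎
  where open ≡-Reasoning

*-isAdditive : ∀ q → IsAdditive (q ℚ.*_)
*-isAdditive q = record { κ-0 = ℚ.*-zeroʳ q ; κ-+ = ℚ.*-distribˡ-+ q }

qmul-fromℕ : ∀ n a → qmul (fromℕ n) a ≋ n × a
qmul-fromℕ n a = coeffwise λ d w → begin
  coeff (reindex (fromℕ n ℚ.*_) 0 [] a ++ []) d w   ≡⟨ cong (λ b → coeff b d w) (List.++-identityʳ (reindex (fromℕ n ℚ.*_) 0 [] a)) ⟩
  coeff (reindex (fromℕ n ℚ.*_) 0 [] a) d w         ≡⟨ coeff-reindex (*-isAdditive (fromℕ n)) 0 [] a d w ⟩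
  fromℕ n ℚ.* coeff a d w                           ≡⟨ coeff-× n a d w ⟨
  coeff (n × a) d w                                 ∎
  where open ≡-Reasoning

neg-isAdditive : IsAdditive (λ q → ℚ.- q)
neg-isAdditive = record { κ-0 = refl ; κ-+ = ℚ.neg-distrib-+ }

⊖-cancelʳ : ∀ a c → (a ⊖ c) ⊕ c ≋ a
⊖-cancelʳ a c = coeffwise λ d w → begin
  coeff ((a ++ neg c) ++ c) d w                           ≡⟨ coeff-++ (a ++ neg c) c d w ⟩
  coeff (a ++ neg c) d w ℚ.+ coeff c d w                  ≡⟨ cong (ℚ._+ coeff c d w) (coeff-++ a (neg c) d w) ⟩
  coeff a d w ℚ.+ coeff (neg c) d w ℚ.+ coeff c d w       ≡⟨ cong (λ q → coeff a d w ℚ.+ q ℚ.+ coeff c d w)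
                                                               (coeff-reindex neg-isAdditive 0 [] c d w) ⟩
  coeff a d w ℚ.+ ℚ.- coeff c d w ℚ.+ coeff c d w         ≡⟨ ℚ.+-assoc (coeff a d w) _ (coeff c d w) ⟩
  coeff a d w ℚ.+ (ℚ.- coeff c d w ℚ.+ coeff c d w)       ≡⟨ cong (coeff a d w ℚ.+_) (ℚ.+-inverseˡ (coeff c d w)) ⟩
  coeff a d w ℚ.+ 0ℚ                                      ≡⟨ ℚ.+-identityʳ (coeff a d w) ⟩
  coeff a d w                                             ∎
  where open ≡-Reasoning

open import Relation.Binary.Reasoning.Setoid setoid
open MonoidMorphisms rawMonoid rawMonoid using () renaming (IsMonoidHomomorphism to IsLinear)
open IsLinear using (homo; ε-homo) renaming (⟦⟧-cong to linear-cong)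

isLinear : ∀ {φ} → (∀ {a a′} → a ≋ a′ → φ a ≋ φ a′) → (∀ a a′ → φ (a ⊕ a′) ≋ φ a ⊕ φ a′) → φ [] ≋ [] →
           IsLinear φ
isLinear φ-cong φ-homo φ-zero = record
  { isMagmaHomomorphism = record { isRelHomomorphism = record { cong = φ-cong } ; homo = φ-homo }
  ; ε-homo = φ-zero }

reindex-isLinear : ∀ {κ} → IsAdditive κ → ∀ s v → IsLinear (reindex κ s v)
reindex-isLinear κ+ s v = isLinear (reindex-cong κ+ s v) (λ a a′ → ≡⇒≋ (List.map-++ _ a a′)) ≋-refl

id-isAdditive : IsAdditive (λ q → q)
id-isAdditive = record { κ-0 = refl ; κ-+ = λ _ _ → refl }

lmul-isLinear : ∀ v → IsLinear (lmul v)
lmul-isLinear = reindex-isLinear id-isAdditive 0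

smul-isLinear : ∀ p → IsLinear (smul p)
smul-isLinear []            = isLinear (λ _ → ≋-refl) (λ _ _ → ≋-refl) ≋-refl
smul-isLinear ((c , e) ∷ p) = isLinear
  (λ a≋a′ → ⊕-cong (linear-cong head a≋a′) (linear-cong tail a≋a′))
  (λ a a′ → ≋-trans (⊕-cong (homo head a a′) (homo tail a a′))
                     (⊕-interchange (reindex (c ℚ.*_) e [] a) (reindex (c ℚ.*_) e [] a′) (smul p a) (smul p a′)))
  (⊕-cong (ε-homo head) (ε-homo tail))
  where
  head = reindex-isLinear (*-isAdditive c) e []
  tail = smul-isLinear p

×-isLinear : ∀ n → IsLinear (n ×_)
×-isLinear n = isLinear (×-congʳ n) (λ a a′ → ×-distrib-+ a a′ n) (×-zero n)
  where
  ×-zero : ∀ n → n × [] ≋ []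
  ×-zero zero    = ≋-refl
  ×-zero (suc n) = ×-zero n

linear-× : ∀ {φ} → IsLinear φ → ∀ n a → φ (n × a) ≋ n × φ a
linear-× φ-lin zero    a = ε-homo φ-lin
linear-× φ-lin (suc n) a = ≋-trans (homo φ-lin a (n × a)) (⊕-congˡ (linear-× φ-lin n a))

∘-isLinear : ∀ {φ ψ} → IsLinear φ → IsLinear ψ → IsLinear (λ a → ψ (φ a))
∘-isLinear = Composition.isMonoidHomomorphism ≋-trans

×-[] : ∀ n {a} → a ≋ [] → n × a ≋ []
×-[] n a≋0 = ≋-trans (×-congʳ n a≋0) (ε-homo (×-isLinear n))

×-× : ∀ m n a → m × (n × a) ≋ n × (m × a)
×-× m n a = linear-× (×-isLinear m) n a

smul-× : ∀ p n a → n × smul p a ≋ smul p (n × a)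
smul-× p n a = ≋-sym (linear-× (smul-isLinear p) n a)

lmul-reindex : ∀ v κ e a → lmul v (reindex κ e [] a) ≡ reindex κ e [] (lmul v a)
lmul-reindex v κ e []      = refl
lmul-reindex v κ e (_ ∷ a) = cong (_ ∷_) (lmul-reindex v κ e a)

lmul-smul : ∀ v p a → lmul v (smul p a) ≋ smul p (lmul v a)
lmul-smul v []            a = ≋-refl
lmul-smul v ((c , e) ∷ p) a = begin
  lmul v (reindex (c ℚ.*_) e [] a ⊕ smul p a)          ≈⟨ homo (lmul-isLinear v) (reindex (c ℚ.*_) e [] a) (smul p a) ⟩
  lmul v (reindex (c ℚ.*_) e [] a) ⊕ lmul v (smul p a) ≈⟨ ⊕-cong (≡⇒≋ (lmul-reindex v (c ℚ.*_) e a)) (lmul-smul v p a) ⟩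
  reindex (c ℚ.*_) e [] (lmul v a) ⊕ smul p (lmul v a) ∎

ΣL : ∀ {A : Set} → List A → (A → H) → H
ΣL us f = hsum (map f us)

hsum-++ : ∀ as bs → hsum (as ++ bs) ≋ hsum as ⊕ hsum bs
hsum-++ []       bs = ≋-refl
hsum-++ (a ∷ as) bs = ≋-trans (⊕-congˡ (hsum-++ as bs)) (≋-sym (⊕-assoc a (hsum as) (hsum bs)))

hsum-concatMap : ∀ {A : Set} (h : A → List H) us → hsum (concatMap h us) ≋ ΣL us (λ u → hsum (h u))
hsum-concatMap h []       = ≋-refl
hsum-concatMap h (u ∷ us) = ≋-trans (hsum-++ (h u) (concatMap h us)) (⊕-congˡ (hsum-concatMap h us))

ΣL-concatMap : ∀ {A B : Set} (h : A → List B) us f → ΣL (concatMap h us) f ≋ ΣL us (λ u → ΣL (h u) f)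
ΣL-concatMap h us f = ≋-trans (≡⇒≋ (cong hsum (List.map-concatMap f h us))) (hsum-concatMap (λ u → map f (h u)) us)

ΣL-map : ∀ {A B : Set} (h : A → B) us (f : B → H) → ΣL (map h us) f ≡ ΣL us (λ u → f (h u))
ΣL-map h us f = cong hsum (sym (List.map-∘ us))

ΣL-cong : ∀ {A : Set} (us : List A) {f g} → (∀ u → f u ≋ g u) → ΣL us f ≋ ΣL us g
ΣL-cong []       f≋g = ≋-refl
ΣL-cong (u ∷ us) f≋g = ⊕-cong (f≋g u) (ΣL-cong us f≋g)

ΣL-⊕ : ∀ {A : Set} (us : List A) f g → ΣL us (λ u → f u ⊕ g u) ≋ ΣL us f ⊕ ΣL us g
ΣL-⊕ []       f g = ≋-refl
ΣL-⊕ (u ∷ us) f g = ≋-trans (⊕-congˡ (ΣL-⊕ us f g)) (⊕-interchange (f u) (g u) (ΣL us f) (ΣL us g))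

linear-ΣL : ∀ {φ} → IsLinear φ → ∀ {A : Set} (us : List A) f → φ (ΣL us f) ≋ ΣL us (λ u → φ (f u))
linear-ΣL φ-lin []       f = ε-homo φ-lin
linear-ΣL φ-lin (u ∷ us) f = ≋-trans (homo φ-lin (f u) (ΣL us f)) (⊕-congˡ (linear-ΣL φ-lin us f))

ΣL-zero : ∀ {A : Set} (us : List A) {f} → (∀ u → f u ≋ []) → ΣL us f ≋ []
ΣL-zero []       f≋0 = ≋-refl
ΣL-zero (u ∷ us) f≋0 = ⊕-cong (f≋0 u) (ΣL-zero us f≋0)

σ : ℕ → (ℕ → H) → H
σ zero    f = []
σ (suc k) f = σ k f ⊕ f (suc k)

ΣL-upTo : ∀ k f → ΣL (map suc (upTo k)) f ≋ σ k f
ΣL-upTo k f = ≋-trans (≡⇒≋ (cong (λ is → ΣL is f) (List.map-upTo suc k))) (applyUpTo k)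
  where
  applyUpTo : ∀ k → ΣL (L.applyUpTo suc k) f ≋ σ k f
  applyUpTo zero    = ≋-refl
  applyUpTo (suc k) = begin
    ΣL (L.applyUpTo suc (suc k)) f           ≡⟨ cong (λ is → ΣL is f) (List.applyUpTo-∷ʳ suc k) ⟨
    ΣL (L.applyUpTo suc k ++ suc k ∷ []) f   ≈⟨ ≡⇒≋ (cong hsum (List.map-++ f (L.applyUpTo suc k) (suc k ∷ []))) ⟩
    hsum (map f (L.applyUpTo suc k) ++ f (suc k) ∷ [])
                                             ≈⟨ hsum-++ (map f (L.applyUpTo suc k)) (f (suc k) ∷ []) ⟩
    ΣL (L.applyUpTo suc k) f ⊕ (f (suc k) ⊕ []) ≈⟨ ⊕-cong (applyUpTo k) (⊕-identityʳ (f (suc k))) ⟩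
    σ k f ⊕ f (suc k)                        ∎

σ-cong : ∀ k {f g} → (∀ i → 1 ≤ i → i ≤ k → f i ≋ g i) → σ k f ≋ σ k g
σ-cong zero    f≋g = ≋-refl
σ-cong (suc k) f≋g = ⊕-cong (σ-cong k λ i 1≤i i≤k → f≋g i 1≤i (ℕ.m≤n⇒m≤1+n i≤k)) (f≋g (suc k) (s≤s z≤n) ℕ.≤-refl)

σ-cong′ : ∀ k {f g} → (∀ i → f i ≋ g i) → σ k f ≋ σ k g
σ-cong′ k f≋g = σ-cong k λ i _ _ → f≋g i

σ-⊕ : ∀ k f g → σ k (λ i → f i ⊕ g i) ≋ σ k f ⊕ σ k g
σ-⊕ zero    f g = ≋-refl
σ-⊕ (suc k) f g = ≋-trans (⊕-congʳ (σ-⊕ k f g)) (⊕-interchange (σ k f) (σ k g) (f (suc k)) (g (suc k)))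

linear-σ : ∀ {φ} → IsLinear φ → ∀ k f → φ (σ k f) ≋ σ k (λ i → φ (f i))
linear-σ φ-lin zero    f = ε-homo φ-lin
linear-σ φ-lin (suc k) f = ≋-trans (homo φ-lin (σ k f) (f (suc k))) (⊕-congʳ (linear-σ φ-lin k f))

σ-zero : ∀ k {f} → (∀ i → 1 ≤ i → i ≤ k → f i ≋ []) → σ k f ≋ []
σ-zero zero    f≋0 = ≋-refl
σ-zero (suc k) f≋0 = ⊕-cong (σ-zero k λ i 1≤i i≤k → f≋0 i 1≤i (ℕ.m≤n⇒m≤1+n i≤k)) (f≋0 (suc k) (s≤s z≤n) ℕ.≤-refl)

σ-unshift : ∀ k f → σ (suc k) f ≋ f 1 ⊕ σ k (λ i → f (suc i))
σ-unshift zero    f = ⊕-comm [] (f 1)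
σ-unshift (suc k) f = ≋-trans (⊕-congʳ (σ-unshift k f)) (⊕-assoc (f 1) (σ k (λ i → f (suc i))) (f (suc (suc k))))

σ-reverse : ∀ k f → σ k f ≋ σ k (λ i → f (suc k ∸ i))
σ-reverse zero    f = ≋-refl
σ-reverse (suc k) f = begin
  σ k f ⊕ f (suc k)                       ≈⟨ ⊕-comm (σ k f) (f (suc k)) ⟩
  f (suc k) ⊕ σ k f                       ≈⟨ ⊕-congˡ (σ-reverse k f) ⟩
  f (suc k) ⊕ σ k (λ i → f (suc k ∸ i))   ≈⟨ σ-unshift k (λ i → f (suc (suc k) ∸ i)) ⟨
  σ (suc k) (λ i → f (suc (suc k) ∸ i))   ∎

σ-× : ∀ k h a → σ k (λ i → h i × a) ≋ sumTo k h × a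
σ-× zero    h a = ≋-refl
σ-× (suc k) h a = ≋-trans (⊕-congʳ (σ-× k h a)) (≋-sym (×-homo-+ a (sumTo k h) (h (suc k))))

σ-diagonal : ∀ k (f : ℕ → ℕ → H) →
             σ k (λ l → σ (k ∸ l) (f l)) ≋ σ k (λ c → σ (c ∸ 1) (λ l → f l (c ∸ l)))
σ-diagonal zero    f = ≋-refl
σ-diagonal (suc k) f = begin
  σ k (λ l → σ (suc k ∸ l) (f l)) ⊕ σ (k ∸ k) (f (suc k))
    ≈⟨ ⊕-cong (σ-cong k λ l _ → peel-last l) (≡⇒≋ (cong (λ j → σ j (f (suc k))) (ℕ.n∸n≡0 k))) ⟩
  σ k (λ l → σ (k ∸ l) (f l) ⊕ f l (suc k ∸ l)) ⊕ []
    ≈⟨ ⊕-identityʳ _ ⟩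
  σ k (λ l → σ (k ∸ l) (f l) ⊕ f l (suc k ∸ l))
    ≈⟨ σ-⊕ k (λ l → σ (k ∸ l) (f l)) (λ l → f l (suc k ∸ l)) ⟩
  σ k (λ l → σ (k ∸ l) (f l)) ⊕ σ k (λ l → f l (suc k ∸ l))
    ≈⟨ ⊕-congʳ (σ-diagonal k f) ⟩
  σ k (λ c → σ (c ∸ 1) (λ l → f l (c ∸ l))) ⊕ σ k (λ l → f l (suc k ∸ l)) ∎
  where
  peel-last : ∀ l → l ≤ k → σ (suc k ∸ l) (f l) ≋ σ (k ∸ l) (f l) ⊕ f l (suc k ∸ l)
  peel-last l l≤k rewrite ℕ.+-∸-assoc 1 l≤k = ≋-refl

σ-swap : ∀ k (f : ℕ → ℕ → H) → σ k (λ l → σ (k ∸ l) (f l)) ≋ σ k (λ a → σ (k ∸ a) (λ l → f l a))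
σ-swap k f = begin
  σ k (λ l → σ (k ∸ l) (f l))                  ≈⟨ σ-diagonal k f ⟩
  σ k (λ c → σ (c ∸ 1) (λ l → f l (c ∸ l)))   ≈⟨ σ-cong k reflect ⟩
  σ k (λ c → σ (c ∸ 1) (λ a → f (c ∸ a) a))   ≈⟨ σ-diagonal k (λ a l → f l a) ⟨
  σ k (λ a → σ (k ∸ a) (λ l → f l a))          ∎
  where
  reflect : ∀ c → 1 ≤ c → c ≤ k → σ (c ∸ 1) (λ l → f l (c ∸ l)) ≋ σ (c ∸ 1) (λ a → f (c ∸ a) a)
  reflect (suc c) _ _ = ≋-trans (σ-reverse c (λ l → f l (suc c ∸ l)))
    (σ-cong c λ a _ a≤c → ≡⇒≋ (cong (f (suc c ∸ a)) (ℕ.m∸[m∸n]≡n (ℕ.m≤n⇒m≤1+n a≤c))))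

σ-diagonal-weightˡ : ∀ k (h : ℕ → ℕ) (g : ℕ → ℕ → H) →
  σ k (λ l → σ (k ∸ l) (λ a → h l × g (l ℕ.+ a) (k ∸ l ∸ a))) ≋ σ k (λ c → sumTo (c ∸ 1) h × g c (k ∸ c))
σ-diagonal-weightˡ k h g = ≋-trans (σ-diagonal k (λ l a → h l × g (l ℕ.+ a) (k ∸ l ∸ a)))
  (σ-cong′ k λ c → ≋-trans (σ-cong (c ∸ 1) λ l _ l≤c-1 → ≡⇒≋ (at-c c l l≤c-1)) (σ-× (c ∸ 1) h (g c (k ∸ c))))
  where
  at-c : ∀ c l → l ≤ c ∸ 1 → h l × g (l ℕ.+ (c ∸ l)) (k ∸ l ∸ (c ∸ l)) ≡ h l × g c (k ∸ c)
  at-c c l l≤c-1 = cong₂ (λ i j → h l × g i j) l+[c∸l]≡c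
    (trans (ℕ.∸-+-assoc k l (c ∸ l)) (cong (k ∸_) l+[c∸l]≡c))
    where l+[c∸l]≡c = ℕ.m+[n∸m]≡n (ℕ.≤-trans l≤c-1 (ℕ.m∸n≤m c 1))

σ-diagonal-weightʳ : ∀ k (h : ℕ → ℕ) (g : ℕ → ℕ → H) →
  σ k (λ l → σ (k ∸ l) (λ a → h a × g (l ℕ.+ a) (k ∸ l ∸ a))) ≋ σ k (λ c → sumTo (c ∸ 1) h × g c (k ∸ c))
σ-diagonal-weightʳ k h g = begin
  σ k (λ l → σ (k ∸ l) (λ a → h a × g (l ℕ.+ a) (k ∸ l ∸ a))) ≈⟨ σ-swap k (λ l a → h a × g (l ℕ.+ a) (k ∸ l ∸ a)) ⟩
  σ k (λ a → σ (k ∸ a) (λ l → h a × g (l ℕ.+ a) (k ∸ l ∸ a))) ≈⟨ σ-cong′ k (λ a → σ-cong′ (k ∸ a) λ l →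
                                                                     ≡⇒≋ (cong₂ (λ i j → h a × g i j) (ℕ.+-comm l a) (∸-comm k l a))) ⟩
  σ k (λ a → σ (k ∸ a) (λ l → h a × g (a ℕ.+ l) (k ∸ a ∸ l))) ≈⟨ σ-diagonal-weightˡ k h g ⟩
  σ k (λ c → sumTo (c ∸ 1) h × g c (k ∸ c)) ∎

ΣC-suc : ∀ k m (g : List ℕ → H) → ΣL (comps k (suc m)) g ≋ σ k (λ a → ΣL (comps (k ∸ a) m) (λ w → g (a ∷ w)))
ΣC-suc k m g = begin
  ΣL (comps k (suc m)) g
    ≡⟨ cong (λ us → ΣL us g) (comps-suc k) ⟩
  ΣL (concatMap (λ a → map (a ∷_) (comps (k ∸ a) m)) (map suc (upTo k))) g
    ≈⟨ ΣL-concatMap (λ a → map (a ∷_) (comps (k ∸ a) m)) (map suc (upTo k)) g ⟩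
  ΣL (map suc (upTo k)) (λ a → ΣL (map (a ∷_) (comps (k ∸ a) m)) g)
    ≈⟨ ΣL-cong (map suc (upTo k)) (λ a → ≡⇒≋ (ΣL-map (a ∷_) (comps (k ∸ a) m) g)) ⟩
  ΣL (map suc (upTo k)) (λ a → ΣL (comps (k ∸ a) m) (λ w → g (a ∷ w)))
    ≈⟨ ΣL-upTo k _ ⟩
  σ k (λ a → ΣL (comps (k ∸ a) m) (λ w → g (a ∷ w))) ∎
  where
  comps-suc : ∀ k → comps k (suc m) ≡ concatMap (λ a → map (a ∷_) (comps (k ∸ a) m)) (map suc (upTo k))
  comps-suc zero    = refl
  comps-suc (suc k) = refl

ΣC-small : ∀ k m g → k < m → ΣL (comps k m) g ≋ []
ΣC-small k (suc m) g k<m = ≋-trans (ΣC-suc k m g)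
  (σ-zero k λ a 1≤a a≤k → ΣC-small (k ∸ a) m _ (ℕ.≤-trans (ℕ.∸-monoʳ-< 1≤a a≤k) (ℕ.≤-pred k<m)))

ΣC-suc-cong : ∀ k m {f g : List ℕ → H} → (∀ a w → 1 ≤ a → f (a ∷ w) ≋ g (a ∷ w)) →
              ΣL (comps k (suc m)) f ≋ ΣL (comps k (suc m)) g
ΣC-suc-cong k m f≋g = ≋-trans (ΣC-suc k m _)
  (≋-trans (σ-cong k λ a 1≤a _ → ΣL-cong (comps (k ∸ a) m) λ w → f≋g a w 1≤a) (≋-sym (ΣC-suc k m _)))

ΣC-zero-cong : ∀ k {f g : List ℕ → H} → f [] ≋ g [] → ΣL (comps k 0) f ≋ ΣL (comps k 0) g
ΣC-zero-cong zero    f[]≋g[] = ⊕-congʳ f[]≋g[]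
ΣC-zero-cong (suc k) _       = ≋-refl

ΣC-zero : ∀ k {g : List ℕ → H} → g [] ≋ [] → ΣL (comps k 0) g ≋ []
ΣC-zero k g[]≋0 = ≋-trans (ΣC-zero-cong k g[]≋0) (ΣL-zero (comps k 0) λ _ → ≋-refl)

ΣL-filterB : ∀ p us (g : List ℕ → H) → ΣL (filterB p us) g ≋ ΣL us (λ u → 𝟙 (p u) × g u)
ΣL-filterB p []       g = ≋-refl
ΣL-filterB p (u ∷ us) g with p u
... | true  = ⊕-cong (≋-sym (⊕-identityʳ (g u))) (ΣL-filterB p us g)
... | false = ΣL-filterB p us g

headed : ℕ → ℕ → ℕ → H
headed c j m = ΣL (comps j m) (λ w → mono (zW (c ∷ w)))

lmul-sumZ : ∀ c us → lmul (zL c) (sumZ us) ≋ ΣL us (λ w → mono (zW (c ∷ w)))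
lmul-sumZ c us = linear-ΣL (lmul-isLinear (zL c)) us (λ w → mono (zW w))

sumZ-suc : ∀ k m → sumZ (comps k (suc m)) ≋ σ k (λ c → headed c (k ∸ c) m)
sumZ-suc k m = ΣC-suc k m (λ u → mono (zW u))

tripleSum : ℕ → ℕ → (ℕ → ℕ → List ℕ → H) → H
tripleSum k m F = σ k (λ l → σ (k ∸ l) (λ a → ΣL (comps (k ∸ l ∸ a) m) (F l a)))

tripleSum-cong : ∀ k m {F G} → (∀ l a w → 1 ≤ a → F l a w ≋ G l a w) → tripleSum k m F ≋ tripleSum k m G
tripleSum-cong k m F≋G = σ-cong′ k λ l → σ-cong (k ∸ l) λ a 1≤a _ → ΣL-cong (comps (k ∸ l ∸ a) m) λ w → F≋G l a w 1≤a

tripleSum-⊕ : ∀ k m F G → tripleSum k m (λ l a w → F l a w ⊕ G l a w) ≋ tripleSum k m F ⊕ tripleSum k m G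
tripleSum-⊕ k m F G = ≋-trans
  (σ-cong′ k λ l → ≋-trans (σ-cong′ (k ∸ l) λ a → ΣL-⊕ (comps (k ∸ l ∸ a) m) (F l a) (G l a)) (σ-⊕ (k ∸ l) _ _))
  (σ-⊕ k _ _)

sumZ-tripleSum : ∀ k m → sumZ (comps k (suc (suc m))) ≋ tripleSum k m (λ l a w → mono (zW (l ∷ a ∷ w)))
sumZ-tripleSum k m = ≋-trans (sumZ-suc k (suc m)) (σ-cong′ k λ l → ΣC-suc (k ∸ l) m (λ w → mono (zW (l ∷ w))))

mergeTerm : ℕ → List ℕ → H
mergeTerm n w = if notBothEmpty [] w then smul t²-t (lmul (replicate n x) (mono (zW w))) else []

∗t-∷ : ∀ l a w → (l ∷ []) ∗t (a ∷ w) ≡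
       ((mono (zW (l ∷ a ∷ w)) ⊕ lmul (zL a) ((l ∷ []) ∗t w)) ⊕ smul oneMinus2t (mono (zW ((l ℕ.+ a) ∷ w))))
       ⊕ mergeTerm (l ℕ.+ a) w
∗t-∷ l a w = refl

mergeTerm-∷ : ∀ n b w → 1 ≤ b → mergeTerm n (b ∷ w) ≡ smul t²-t (mono (zW ((n ℕ.+ b) ∷ w)))
mergeTerm-∷ n (suc b) w _ = cong (λ u → smul t²-t (mono u))
  (trans (sym (List.++-assoc (replicate n x) (zL (suc b)) (zW w))) (cong (_++ zW w) (replicate-x-++-zL n b)))

linear-tripleSum : ∀ {φ} → IsLinear φ → ∀ k m F → φ (tripleSum k m F) ≋ tripleSum k m (λ l a w → φ (F l a w))
linear-tripleSum φ-lin k m F = ≋-trans (linear-σ φ-lin k _) (σ-cong′ k λ l → ≋-trans (linear-σ φ-lin (k ∸ l) _)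
  (σ-cong′ (k ∸ l) λ a → linear-ΣL φ-lin (comps (k ∸ l ∸ a) m) (F l a)))

tripleSum-swap : ∀ k m (φ : ℕ → H → H) → (∀ a → IsLinear (φ a)) → ∀ (F : ℕ → List ℕ → H) →
  tripleSum k m (λ l a w → φ a (F l w)) ≋ σ k (λ a → φ a (σ (k ∸ a) (λ l → ΣL (comps (k ∸ a ∸ l) m) (F l))))
tripleSum-swap k m φ φ-lin F = begin
  tripleSum k m (λ l a w → φ a (F l w))
    ≈⟨ σ-cong′ k (λ l → σ-cong′ (k ∸ l) λ a → linear-ΣL (φ-lin a) (comps (k ∸ l ∸ a) m) (F l)) ⟨
  σ k (λ l → σ (k ∸ l) (λ a → φ a (ΣL (comps (k ∸ l ∸ a) m) (F l))))
    ≈⟨ σ-swap k (λ l a → φ a (ΣL (comps (k ∸ l ∸ a) m) (F l))) ⟩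
  σ k (λ a → σ (k ∸ a) (λ l → φ a (ΣL (comps (k ∸ l ∸ a) m) (F l))))
    ≈⟨ σ-cong′ k (λ a → σ-cong′ (k ∸ a) λ l → ≡⇒≋ (cong (λ j → φ a (ΣL (comps j m) (F l))) (∸-comm k l a))) ⟩
  σ k (λ a → σ (k ∸ a) (λ l → φ a (ΣL (comps (k ∸ a ∸ l) m) (F l))))
    ≈⟨ σ-cong′ k (λ a → linear-σ (φ-lin a) (k ∸ a) _) ⟨
  σ k (λ a → φ a (σ (k ∸ a) (λ l → ΣL (comps (k ∸ a ∸ l) m) (F l)))) ∎

harmonicSum : ℕ → ℕ → H
harmonicSum k m = σ k (λ l → ΣL (comps (k ∸ l) m) (λ w → (l ∷ []) ∗t w))

β : List ℕ → ℕ
β u = sum (map (λ a → (a ∸ 1) C 2) u)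

βSum : ℕ → ℕ → H
βSum k j = ΣL (comps k j) (λ u → β u × mono (zW u))

harmonicFormula : ℕ → ℕ → H
harmonicFormula k m =
  (suc m × sumZ (comps k (suc m)) ⊕ smul oneMinus2t ((k ∸ m) × sumZ (comps k m))) ⊕ smul t²-t (βSum k (m ∸ 1))

lmul-harmonicFormula : ∀ a j m → lmul (zL a) (harmonicFormula j m) ≋
  (suc m × headed a j (suc m) ⊕ smul oneMinus2t ((j ∸ m) × headed a j m))
  ⊕ smul t²-t (ΣL (comps j (m ∸ 1)) (λ w → β w × mono (zW (a ∷ w))))
lmul-harmonicFormula a j m = begin
  lmul z (harmonicFormula j m)
    ≈⟨ ≋-trans (homo z-lin (suc m × Z₊ ⊕ O) W) (⊕-congʳ (homo z-lin (suc m × Z₊) O)) ⟩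
  (lmul z (suc m × Z₊) ⊕ lmul z (smul oneMinus2t ((j ∸ m) × Z))) ⊕ lmul z (smul t²-t (βSum j (m ∸ 1)))
    ≈⟨ ⊕-cong (⊕-cong (linear-× z-lin (suc m) Z₊) (lmul-smul z oneMinus2t ((j ∸ m) × Z))) (lmul-smul z t²-t (βSum j (m ∸ 1))) ⟩
  (suc m × lmul z Z₊ ⊕ smul oneMinus2t (lmul z ((j ∸ m) × Z))) ⊕ smul t²-t (lmul z (βSum j (m ∸ 1)))
    ≈⟨ ⊕-cong (⊕-cong (×-congʳ (suc m) (lmul-sumZ a (comps j (suc m))))
                      (linear-cong (smul-isLinear oneMinus2t) (≋-trans (linear-× z-lin (j ∸ m) Z) (×-congʳ (j ∸ m) (lmul-sumZ a (comps j m))))))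
              (linear-cong (smul-isLinear t²-t) (≋-trans (linear-ΣL z-lin (comps j (m ∸ 1)) _)
                 (ΣL-cong (comps j (m ∸ 1)) λ w → linear-× z-lin (β w) (mono (zW w))))) ⟩
  (suc m × headed a j (suc m) ⊕ smul oneMinus2t ((j ∸ m) × headed a j m))
    ⊕ smul t²-t (ΣL (comps j (m ∸ 1)) (λ w → β w × mono (zW (a ∷ w)))) ∎
  where
  z = zL a
  z-lin = lmul-isLinear z
  Z₊ = sumZ (comps j (suc m))
  Z = sumZ (comps j m)
  O = smul oneMinus2t ((j ∸ m) × Z)
  W = smul t²-t (βSum j (m ∸ 1))

-- r = 0 gives the unrestricted sums, r = 1 the sums over I⁰ of the theorem (bᵣ 1 is b).
firstAbove : ℕ → List ℕ → Bool
firstAbove r []      = false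
firstAbove r (a ∷ _) = r <ᵇ a

bᵣ : ℕ → List ℕ → ℕ
bᵣ r []      = 0
bᵣ r (a ∷ w) = (a ∸ suc r) C 2 ℕ.+ β w

Zᵣ : ℕ → ℕ → ℕ → H
Zᵣ r k j = ΣL (comps k j) (λ u → 𝟙 (firstAbove r u) × mono (zW u))

Bᵣ : ℕ → ℕ → ℕ → H
Bᵣ r k j = ΣL (comps k j) (λ u → 𝟙 (firstAbove r u) × (bᵣ r u × mono (zW u)))

restrictedFormula : ℕ → ℕ → ℕ → H
restrictedFormula r k m =
  (suc m × Zᵣ r k (suc (suc m)) ⊕ smul oneMinus2t ((k ∸ (m ℕ.+ suc r)) × Zᵣ r k (suc m))) ⊕ smul t²-t (Bᵣ r k m)

Zᵣ-suc : ∀ r k j → Zᵣ r k (suc j) ≋ σ k (λ c → above r c × headed c (k ∸ c) j)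
Zᵣ-suc r k j = ≋-trans (ΣC-suc k j _) (σ-cong′ k λ c →
  ≋-sym (linear-ΣL (×-isLinear (above r c)) (comps (k ∸ c) j) (λ w → mono (zW (c ∷ w)))))

oneMinus2t-weights : ∀ k m r c → c ≤ k →
  above r c × ((k ∸ c ∸ m) × headed c (k ∸ c) m) ⊕ (c ∸ suc r) × headed c (k ∸ c) m
  ≋ (k ∸ (m ℕ.+ suc r)) × (above r c × headed c (k ∸ c) m)
oneMinus2t-weights k m r c c≤k with m ℕ.≤? k ∸ c
... | yes m≤k∸c = begin
  above r c × ((k ∸ c ∸ m) × Y) ⊕ (c ∸ suc r) × Y   ≈⟨ ⊕-congʳ (×-assocˡ Y (above r c) (k ∸ c ∸ m)) ⟩
  (above r c ℕ.* (k ∸ c ∸ m)) × Y ⊕ (c ∸ suc r) × Y ≈⟨ ×-homo-+ Y (above r c ℕ.* (k ∸ c ∸ m)) (c ∸ suc r) ⟨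
  (above r c ℕ.* (k ∸ c ∸ m) ℕ.+ (c ∸ suc r)) × Y   ≡⟨ cong (_× Y) (above-merge k c m r c+m≤k) ⟩
  ((k ∸ (m ℕ.+ suc r)) ℕ.* above r c) × Y           ≈⟨ ×-assocˡ Y (k ∸ (m ℕ.+ suc r)) (above r c) ⟨
  (k ∸ (m ℕ.+ suc r)) × (above r c × Y)             ∎
  where
  Y = headed c (k ∸ c) m
  c+m≤k = ℕ.≤-trans (ℕ.+-monoʳ-≤ c m≤k∸c) (ℕ.≤-reflexive (ℕ.m+[n∸m]≡n c≤k))
... | no m≰k∸c = ≋-trans (⊕-cong (×-[] (above r c) (×-[] (k ∸ c ∸ m) Y≋0)) (×-[] (c ∸ suc r) Y≋0))
                         (≋-sym (×-[] (k ∸ (m ℕ.+ suc r)) (×-[] (above r c) Y≋0)))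
  where Y≋0 = ΣC-small (k ∸ c) m _ (ℕ.≰⇒> m≰k∸c)

oneMinus2t-part : ∀ r k m →
  σ k (λ a → above r a × smul oneMinus2t ((k ∸ a ∸ m) × headed a (k ∸ a) m))
  ⊕ smul oneMinus2t (σ k (λ c → (c ∸ suc r) × headed c (k ∸ c) m))
  ≋ smul oneMinus2t ((k ∸ (m ℕ.+ suc r)) × Zᵣ r k (suc m))
oneMinus2t-part r k m = begin
  σ k (λ a → above r a × o (n a × Y a)) ⊕ o (σ k (λ c → d c × Y c))
    ≈⟨ ⊕-congʳ (≋-trans (σ-cong′ k λ a → smul-× oneMinus2t (above r a) (n a × Y a))
                        (≋-sym (linear-σ o-lin k (λ a → above r a × (n a × Y a))))) ⟩
  o (σ k (λ a → above r a × (n a × Y a))) ⊕ o (σ k (λ c → d c × Y c))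
    ≈⟨ ≋-trans (linear-cong o-lin (σ-⊕ k (λ c → above r c × (n c × Y c)) (λ c → d c × Y c)))
               (homo o-lin (σ k (λ a → above r a × (n a × Y a))) (σ k (λ c → d c × Y c))) ⟨
  o (σ k (λ c → above r c × (n c × Y c) ⊕ d c × Y c))
    ≈⟨ linear-cong o-lin (σ-cong k λ c _ c≤k → oneMinus2t-weights k m r c c≤k) ⟩
  o (σ k (λ c → K × (above r c × Y c)))
    ≈⟨ linear-cong o-lin (≋-trans (≋-sym (linear-σ (×-isLinear K) k (λ c → above r c × Y c)))
                                  (×-congʳ K (≋-sym (Zᵣ-suc r k m)))) ⟩
  o (K × Zᵣ r k (suc m)) ∎
  where
  o = smul oneMinus2t
  o-lin = smul-isLinear oneMinus2t
  Y : ℕ → H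
  Y c = headed c (k ∸ c) m
  n d : ℕ → ℕ
  n a = k ∸ a ∸ m
  d c = c ∸ suc r
  K = k ∸ (m ℕ.+ suc r)

tripleSum-above : ∀ r k m (G : ℕ → List ℕ → H) →
  tripleSum k m (λ l a w → above r a × G (l ℕ.+ a) w) ≋ σ k (λ c → (c ∸ suc r) × ΣL (comps (k ∸ c) m) (G c))
tripleSum-above r k m G = begin
  tripleSum k m (λ l a w → above r a × G (l ℕ.+ a) w)
    ≈⟨ σ-cong′ k (λ l → σ-cong′ (k ∸ l) λ a → linear-ΣL (×-isLinear (above r a)) (comps (k ∸ l ∸ a) m) (G (l ℕ.+ a))) ⟨
  σ k (λ l → σ (k ∸ l) (λ a → above r a × ΣL (comps (k ∸ l ∸ a) m) (G (l ℕ.+ a))))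
    ≈⟨ σ-diagonal-weightʳ k (above r) (λ c j → ΣL (comps j m) (G c)) ⟩
  σ k (λ c → sumTo (c ∸ 1) (above r) × ΣL (comps (k ∸ c) m) (G c))
    ≈⟨ σ-cong′ k (λ c → ≡⇒≋ (cong (_× ΣL (comps (k ∸ c) m) (G c)) (sumTo-above-pred c))) ⟩
  σ k (λ c → (c ∸ suc r) × ΣL (comps (k ∸ c) m) (G c)) ∎
  where
  sumTo-above-pred : ∀ c → sumTo (c ∸ 1) (above r) ≡ c ∸ suc r
  sumTo-above-pred c = trans (sumTo-above r (c ∸ 1)) (ℕ.∸-+-assoc c 1 r)

ΣL-mergeTerm : ∀ c j m → ΣL (comps j (suc m)) (mergeTerm c) ≋ smul t²-t (σ j (λ b → headed (c ℕ.+ b) (j ∸ b) m))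
ΣL-mergeTerm c j m = begin
  ΣL (comps j (suc m)) (mergeTerm c)
    ≈⟨ ΣC-suc j m (mergeTerm c) ⟩
  σ j (λ b → ΣL (comps (j ∸ b) m) (λ w → mergeTerm c (b ∷ w)))
    ≈⟨ σ-cong j (λ b 1≤b _ → ΣL-cong (comps (j ∸ b) m) λ w → ≡⇒≋ (mergeTerm-∷ c b w 1≤b)) ⟩
  σ j (λ b → ΣL (comps (j ∸ b) m) (λ w → smul t²-t (mono (zW ((c ℕ.+ b) ∷ w)))))
    ≈⟨ σ-cong′ j (λ b → linear-ΣL t-lin (comps (j ∸ b) m) (λ w → mono (zW ((c ℕ.+ b) ∷ w)))) ⟨
  σ j (λ b → smul t²-t (headed (c ℕ.+ b) (j ∸ b) m))
    ≈⟨ linear-σ t-lin j (λ b → headed (c ℕ.+ b) (j ∸ b) m) ⟨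
  smul t²-t (σ j (λ b → headed (c ℕ.+ b) (j ∸ b) m)) ∎
  where t-lin = smul-isLinear t²-t

tripleSum-mergeTerm : ∀ r k m →
  tripleSum k (suc m) (λ l a w → above r a × mergeTerm (l ℕ.+ a) w)
  ≋ smul t²-t (σ k (λ c → ((c ∸ suc r) C 2) × headed c (k ∸ c) m))
tripleSum-mergeTerm r k m = begin
  tripleSum k (suc m) (λ l a w → above r a × mergeTerm (l ℕ.+ a) w)
    ≈⟨ tripleSum-above r k (suc m) mergeTerm ⟩
  σ k (λ c → (c ∸ suc r) × ΣL (comps (k ∸ c) (suc m)) (mergeTerm c))
    ≈⟨ σ-cong′ k (λ c → ×-congʳ (c ∸ suc r) (ΣL-mergeTerm c (k ∸ c) m)) ⟩
  σ k (λ c → (c ∸ suc r) × smul t²-t (σ (k ∸ c) (λ b → g (c ℕ.+ b) (k ∸ c ∸ b))))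
    ≈⟨ σ-cong′ k (λ c → ≋-trans (smul-× t²-t (c ∸ suc r) _) (linear-cong t-lin (linear-σ (×-isLinear (c ∸ suc r)) (k ∸ c) _))) ⟩
  σ k (λ c → smul t²-t (σ (k ∸ c) (λ b → (c ∸ suc r) × g (c ℕ.+ b) (k ∸ c ∸ b))))
    ≈⟨ linear-σ t-lin k _ ⟨
  smul t²-t (σ k (λ c → σ (k ∸ c) (λ b → (c ∸ suc r) × g (c ℕ.+ b) (k ∸ c ∸ b))))
    ≈⟨ linear-cong t-lin (σ-diagonal-weightˡ k (λ i → i ∸ suc r) g) ⟩
  smul t²-t (σ k (λ c → sumTo (c ∸ 1) (λ i → i ∸ suc r) × g c (k ∸ c)))
    ≈⟨ linear-cong t-lin (σ-cong′ k λ c → ≡⇒≋ (cong (_× g c (k ∸ c)) (weight-C2 c))) ⟩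
  smul t²-t (σ k (λ c → ((c ∸ suc r) C 2) × g c (k ∸ c))) ∎
  where
  t-lin = smul-isLinear t²-t
  g : ℕ → ℕ → H
  g c j = headed c j m
  weight-C2 : ∀ c → sumTo (c ∸ 1) (λ i → i ∸ suc r) ≡ (c ∸ suc r) C 2
  weight-C2 c = trans (sumTo-∸ r (c ∸ 1)) (cong (_C 2) (ℕ.∸-+-assoc c 1 r))

βSum-headed : ∀ r c j m →
  above r c × ΣL (comps j m) (λ w → β w × mono (zW (c ∷ w))) ⊕ ((c ∸ suc r) C 2) × headed c j m
  ≋ ΣL (comps j m) (λ w → above r c × (bᵣ r (c ∷ w) × mono (zW (c ∷ w))))
βSum-headed r c j m = begin
  above r c × ΣL ws (λ w → β w × z w) ⊕ q × ΣL ws z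
    ≈⟨ ⊕-cong (linear-ΣL (×-isLinear (above r c)) ws (λ w → β w × z w)) (linear-ΣL (×-isLinear q) ws z) ⟩
  ΣL ws (λ w → above r c × (β w × z w)) ⊕ ΣL ws (λ w → q × z w)
    ≈⟨ ≋-trans (ΣL-⊕ ws (λ w → q × z w) (λ w → above r c × (β w × z w))) (⊕-comm (ΣL ws (λ w → q × z w)) _) ⟨
  ΣL ws (λ w → q × z w ⊕ above r c × (β w × z w))
    ≈⟨ ΣL-cong ws split ⟨
  ΣL ws (λ w → above r c × ((q ℕ.+ β w) × z w)) ∎
  where
  ws = comps j m
  q = (c ∸ suc r) C 2
  z : List ℕ → H
  z w = mono (zW (c ∷ w))
  split : ∀ w → above r c × ((q ℕ.+ β w) × z w) ≋ q × z w ⊕ above r c × (β w × z w)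
  split w = begin
    above r c × ((q ℕ.+ β w) × z w)               ≈⟨ ×-congʳ (above r c) (×-homo-+ (z w) q (β w)) ⟩
    above r c × (q × z w ⊕ β w × z w)             ≈⟨ ×-distrib-+ (q × z w) (β w × z w) (above r c) ⟩
    above r c × (q × z w) ⊕ above r c × (β w × z w) ≈⟨ ⊕-congʳ (×-assocˡ (z w) (above r c) q) ⟩
    (above r c ℕ.* q) × z w ⊕ above r c × (β w × z w) ≡⟨ cong (λ n → n × z w ⊕ above r c × (β w × z w)) (above-C2 r c) ⟩
    q × z w ⊕ above r c × (β w × z w)             ∎

t²-t-part : ∀ r k m →
  σ k (λ a → above r a × smul t²-t (ΣL (comps (k ∸ a) (m ∸ 1)) (λ w → β w × mono (zW (a ∷ w)))))
  ⊕ tripleSum k m (λ l a w → above r a × mergeTerm (l ℕ.+ a) w)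
  ≋ smul t²-t (Bᵣ r k m)
t²-t-part r k zero = ≋-trans
  (⊕-cong (σ-zero k λ a _ _ → ×-[] (above r a) (≋-trans (linear-cong t-lin (ΣC-zero (k ∸ a) ≋-refl)) (ε-homo t-lin)))
          (σ-zero k λ l _ _ → σ-zero (k ∸ l) λ a _ _ → ΣC-zero (k ∸ l ∸ a) (×-[] (above r a) ≋-refl)))
  (≋-sym (≋-trans (linear-cong t-lin (ΣC-zero k ≋-refl)) (ε-homo t-lin)))
  where t-lin = smul-isLinear t²-t
t²-t-part r k (suc m) = begin
  σ k (λ a → above r a × smul t²-t (W a)) ⊕ tripleSum k (suc m) (λ l a w → above r a × mergeTerm (l ℕ.+ a) w)
    ≈⟨ ⊕-cong (≋-trans (σ-cong′ k λ a → smul-× t²-t (above r a) (W a)) (≋-sym (linear-σ t-lin k _))) (tripleSum-mergeTerm r k m) ⟩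
  smul t²-t (σ k (λ a → above r a × W a)) ⊕ smul t²-t (σ k (λ c → ((c ∸ suc r) C 2) × headed c (k ∸ c) m))
    ≈⟨ ≋-trans (linear-cong t-lin (σ-⊕ k (λ c → above r c × W c) V)) (homo t-lin (σ k (λ c → above r c × W c)) (σ k V)) ⟨
  smul t²-t (σ k (λ c → above r c × W c ⊕ ((c ∸ suc r) C 2) × headed c (k ∸ c) m))
    ≈⟨ linear-cong t-lin (σ-cong′ k λ c → βSum-headed r c (k ∸ c) m) ⟩
  smul t²-t (σ k (λ c → ΣL (comps (k ∸ c) m) (λ w → above r c × (bᵣ r (c ∷ w) × mono (zW (c ∷ w))))))
    ≈⟨ linear-cong t-lin (ΣC-suc k m _) ⟨
  smul t²-t (Bᵣ r k (suc m)) ∎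
  where
  t-lin = smul-isLinear t²-t
  W : ℕ → H
  W a = ΣL (comps (k ∸ a) m) (λ w → β w × mono (zW (a ∷ w)))
  V : ℕ → H
  V c = ((c ∸ suc r) C 2) × headed c (k ∸ c) m

tripleSum-∗t : ∀ r k m → tripleSum k m (λ l a w → above r a × ((l ∷ []) ∗t (a ∷ w))) ≋
  ((tripleSum k m (λ l a w → above r a × mono (zW (l ∷ a ∷ w)))
    ⊕ tripleSum k m (λ l a w → above r a × lmul (zL a) ((l ∷ []) ∗t w)))
    ⊕ tripleSum k m (λ l a w → above r a × smul oneMinus2t (mono (zW ((l ℕ.+ a) ∷ w)))))
    ⊕ tripleSum k m (λ l a w → above r a × mergeTerm (l ℕ.+ a) w)
tripleSum-∗t r k m = begin
  tripleSum k m (λ l a w → above r a × ((l ∷ []) ∗t (a ∷ w)))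
    ≈⟨ tripleSum-cong k m (λ l a w _ → ≋-trans (×-congʳ (above r a) (≡⇒≋ (∗t-∷ l a w))) (distrib (above r a) _ _ _ _)) ⟩
  tripleSum k m (λ l a w → ((T₁ l a w ⊕ T₂ l a w) ⊕ T₃ l a w) ⊕ T₄ l a w)
    ≈⟨ tripleSum-⊕ k m _ T₄ ⟩
  tripleSum k m (λ l a w → (T₁ l a w ⊕ T₂ l a w) ⊕ T₃ l a w) ⊕ tripleSum k m T₄
    ≈⟨ ⊕-congʳ (≋-trans (tripleSum-⊕ k m _ T₃) (⊕-congʳ (tripleSum-⊕ k m T₁ T₂))) ⟩
  ((tripleSum k m T₁ ⊕ tripleSum k m T₂) ⊕ tripleSum k m T₃) ⊕ tripleSum k m T₄ ∎
  where
  T₁ T₂ T₃ T₄ : ℕ → ℕ → List ℕ → H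
  T₁ l a w = above r a × mono (zW (l ∷ a ∷ w))
  T₂ l a w = above r a × lmul (zL a) ((l ∷ []) ∗t w)
  T₃ l a w = above r a × smul oneMinus2t (mono (zW ((l ℕ.+ a) ∷ w)))
  T₄ l a w = above r a × mergeTerm (l ℕ.+ a) w
  distrib : ∀ n p q s t → n × (((p ⊕ q) ⊕ s) ⊕ t) ≋ ((n × p ⊕ n × q) ⊕ n × s) ⊕ n × t
  distrib n p q s t = ≋-trans (homo n-lin _ t) (⊕-congʳ (≋-trans (homo n-lin _ s) (⊕-congʳ (homo n-lin p q))))
    where n-lin = ×-isLinear n

tripleSum-lmul : ∀ r m → (∀ j → harmonicSum j m ≋ harmonicFormula j m) → ∀ k →
  tripleSum k m (λ l a w → above r a × lmul (zL a) ((l ∷ []) ∗t w)) ≋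
  (σ k (λ a → above r a × (suc m × headed a (k ∸ a) (suc m)))
   ⊕ σ k (λ a → above r a × smul oneMinus2t ((k ∸ a ∸ m) × headed a (k ∸ a) m)))
   ⊕ σ k (λ a → above r a × smul t²-t (ΣL (comps (k ∸ a) (m ∸ 1)) (λ w → β w × mono (zW (a ∷ w)))))
tripleSum-lmul r m formula k = begin
  tripleSum k m (λ l a w → above r a × lmul (zL a) ((l ∷ []) ∗t w))
    ≈⟨ tripleSum-swap k m (λ a b → above r a × lmul (zL a) b) (λ a → ∘-isLinear (lmul-isLinear (zL a)) (×-isLinear (above r a)))
                      (λ l w → (l ∷ []) ∗t w) ⟩
  σ k (λ a → above r a × lmul (zL a) (harmonicSum (k ∸ a) m))
    ≈⟨ σ-cong′ k (λ a → ×-congʳ (above r a) (≋-trans (linear-cong (lmul-isLinear (zL a)) (formula (k ∸ a)))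
                                                      (lmul-harmonicFormula a (k ∸ a) m))) ⟩
  σ k (λ a → above r a × ((P a ⊕ O a) ⊕ W a))
    ≈⟨ σ-cong′ k (λ a → ≋-trans (homo (×-isLinear (above r a)) (P a ⊕ O a) (W a))
                                (⊕-congʳ (homo (×-isLinear (above r a)) (P a) (O a)))) ⟩
  σ k (λ a → (above r a × P a ⊕ above r a × O a) ⊕ above r a × W a)
    ≈⟨ ≋-trans (σ-⊕ k _ _) (⊕-congʳ (σ-⊕ k _ _)) ⟩
  (σ k (λ a → above r a × P a) ⊕ σ k (λ a → above r a × O a)) ⊕ σ k (λ a → above r a × W a) ∎
  where
  P O W : ℕ → H
  P a = suc m × headed a (k ∸ a) (suc m)
  O a = smul oneMinus2t ((k ∸ a ∸ m) × headed a (k ∸ a) m)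
  W a = smul t²-t (ΣL (comps (k ∸ a) (m ∸ 1)) (λ w → β w × mono (zW (a ∷ w))))

tripleSum-oneMinus2t : ∀ r k m → tripleSum k m (λ l a w → above r a × smul oneMinus2t (mono (zW ((l ℕ.+ a) ∷ w))))
                           ≋ smul oneMinus2t (σ k (λ c → (c ∸ suc r) × headed c (k ∸ c) m))
tripleSum-oneMinus2t r k m = begin
  tripleSum k m (λ l a w → above r a × smul oneMinus2t (mono (zW ((l ℕ.+ a) ∷ w))))
    ≈⟨ tripleSum-cong k m (λ l a w _ → smul-× oneMinus2t (above r a) _) ⟩
  tripleSum k m (λ l a w → smul oneMinus2t (above r a × mono (zW ((l ℕ.+ a) ∷ w))))
    ≈⟨ linear-tripleSum (smul-isLinear oneMinus2t) k m _ ⟨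
  smul oneMinus2t (tripleSum k m (λ l a w → above r a × mono (zW ((l ℕ.+ a) ∷ w))))
    ≈⟨ linear-cong (smul-isLinear oneMinus2t) (tripleSum-above r k m (λ c w → mono (zW (c ∷ w)))) ⟩
  smul oneMinus2t (σ k (λ c → (c ∸ suc r) × headed c (k ∸ c) m)) ∎

restrictedSum-expansion : ∀ r m → (∀ j → harmonicSum j m ≋ harmonicFormula j m) → ∀ k →
  tripleSum k m (λ l a w → above r a × ((l ∷ []) ∗t (a ∷ w)))
  ≋ tripleSum k m (λ l a w → above r a × mono (zW (l ∷ a ∷ w))) ⊕ restrictedFormula r k m
restrictedSum-expansion r m formula k = begin
  tripleSum k m (λ l a w → above r a × ((l ∷ []) ∗t (a ∷ w)))
    ≈⟨ ≋-trans (tripleSum-∗t r k m)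
         (⊕-cong (⊕-cong (⊕-cong (≋-refl {T₁}) (tripleSum-lmul r m formula k)) (tripleSum-oneMinus2t r k m)) (≋-refl {W′})) ⟩
  ((T₁ ⊕ ((P ⊕ O) ⊕ W)) ⊕ O′) ⊕ W′
    ≈⟨ rearrange T₁ P O W O′ W′ ⟩
  T₁ ⊕ ((P ⊕ (O ⊕ O′)) ⊕ (W ⊕ W′))
    ≈⟨ ⊕-cong (≋-refl {T₁}) (⊕-cong (⊕-cong leading (oneMinus2t-part r k m)) (t²-t-part r k m)) ⟩
  T₁ ⊕ restrictedFormula r k m ∎
  where
  T₁ = tripleSum k m (λ l a w → above r a × mono (zW (l ∷ a ∷ w)))
  P = σ k (λ a → above r a × (suc m × headed a (k ∸ a) (suc m)))
  O = σ k (λ a → above r a × smul oneMinus2t ((k ∸ a ∸ m) × headed a (k ∸ a) m))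
  W = σ k (λ a → above r a × smul t²-t (ΣL (comps (k ∸ a) (m ∸ 1)) (λ w → β w × mono (zW (a ∷ w)))))
  O′ = smul oneMinus2t (σ k (λ c → (c ∸ suc r) × headed c (k ∸ c) m))
  W′ = tripleSum k m (λ l a w → above r a × mergeTerm (l ℕ.+ a) w)
  rearrange : ∀ t p o w o′ w′ → ((t ⊕ ((p ⊕ o) ⊕ w)) ⊕ o′) ⊕ w′ ≋ t ⊕ ((p ⊕ (o ⊕ o′)) ⊕ (w ⊕ w′))
  rearrange = solve 6 (λ t p o w o′ w′ → ((t ⊞ ((p ⊞ o) ⊞ w)) ⊞ o′) ⊞ w′ ⊜ t ⊞ ((p ⊞ (o ⊞ o′)) ⊞ (w ⊞ w′))) ≋-refl
    where _⊞_ = ⊕-Solver._⊕_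
  leading : P ≋ suc m × Zᵣ r k (suc (suc m))
  leading = begin
    P                                                          ≈⟨ σ-cong′ k (λ a → ×-× (above r a) (suc m) _) ⟩
    σ k (λ a → suc m × (above r a × headed a (k ∸ a) (suc m))) ≈⟨ linear-σ (×-isLinear (suc m)) k _ ⟨
    suc m × σ k (λ a → above r a × headed a (k ∸ a) (suc m))   ≈⟨ ×-congʳ (suc m) (Zᵣ-suc r k (suc m)) ⟨
    suc m × Zᵣ r k (suc (suc m))                               ∎

above₀-× : ∀ a a′ → 1 ≤ a → above 0 a × a′ ≋ a′
above₀-× (suc _) a′ _ = ×-homo-1 a′

Zᵣ₀≋sumZ : ∀ k j → Zᵣ 0 k (suc j) ≋ sumZ (comps k (suc j))
Zᵣ₀≋sumZ k j = ΣC-suc-cong k j λ a w 1≤a → above₀-× a (mono (zW (a ∷ w))) 1≤a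

Bᵣ₀≋βSum : ∀ k m → Bᵣ 0 k m ≋ βSum k m
Bᵣ₀≋βSum k zero    = ΣC-zero-cong k ≋-refl
Bᵣ₀≋βSum k (suc m) = ΣC-suc-cong k m λ a w 1≤a → above₀-× a (β (a ∷ w) × mono (zW (a ∷ w))) 1≤a

harmonicFormula-zero : ∀ k → harmonicSum k 0 ≋ harmonicFormula k 0
harmonicFormula-zero k = begin
  harmonicSum k 0
    ≈⟨ σ-cong′ k (λ l → ΣC-zero-cong (k ∸ l) ≋-refl) ⟩
  σ k (λ l → headed l (k ∸ l) 0)
    ≈⟨ sumZ-suc k 0 ⟨
  sumZ (comps k 1)
    ≈⟨ ≋-trans (⊕-identityʳ _) (⊕-identityʳ _) ⟨
  (sumZ (comps k 1) ⊕ []) ⊕ []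
    ≈⟨ ⊕-cong (⊕-cong (×-homo-1 (sumZ (comps k 1))) (vanishing-oneMinus2t k)) vanishing-t²-t ⟨
  harmonicFormula k 0 ∎
  where
  vanishing-oneMinus2t : ∀ k → smul oneMinus2t ((k ∸ 0) × sumZ (comps k 0)) ≋ []
  vanishing-oneMinus2t zero    = ε-homo (smul-isLinear oneMinus2t)
  vanishing-oneMinus2t (suc k) =
    ≋-trans (linear-cong (smul-isLinear oneMinus2t) (×-[] (suc k) ≋-refl)) (ε-homo (smul-isLinear oneMinus2t))
  vanishing-t²-t : smul t²-t (βSum k 0) ≋ []
  vanishing-t²-t = ≋-trans (linear-cong (smul-isLinear t²-t) (ΣC-zero k ≋-refl)) (ε-homo (smul-isLinear t²-t))

harmonicFormula-suc : ∀ m → (∀ j → harmonicSum j m ≋ harmonicFormula j m) →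
                      ∀ k → harmonicSum k (suc m) ≋ harmonicFormula k (suc m)
harmonicFormula-suc m formula k = begin
  harmonicSum k (suc m)
    ≈⟨ σ-cong′ k (λ l → ΣC-suc (k ∸ l) m (λ w → (l ∷ []) ∗t w)) ⟩
  tripleSum k m (λ l a w → (l ∷ []) ∗t (a ∷ w))
    ≈⟨ tripleSum-cong k m (λ l a w → above₀-× a ((l ∷ []) ∗t (a ∷ w))) ⟨
  tripleSum k m (λ l a w → above 0 a × ((l ∷ []) ∗t (a ∷ w)))
    ≈⟨ restrictedSum-expansion 0 m formula k ⟩
  tripleSum k m (λ l a w → above 0 a × mono (zW (l ∷ a ∷ w))) ⊕ restrictedFormula 0 k m
    ≈⟨ ⊕-cong (≋-trans (tripleSum-cong k m λ l a w → above₀-× a (mono (zW (l ∷ a ∷ w)))) (≋-sym (sumZ-tripleSum k m)))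
              (⊕-cong (⊕-cong (×-congʳ (suc m) (Zᵣ₀≋sumZ k (suc m)))
                              (linear-cong (smul-isLinear oneMinus2t) (×-cong (cong (k ∸_) (ℕ.+-comm m 1)) (Zᵣ₀≋sumZ k m))))
                      (linear-cong (smul-isLinear t²-t) (Bᵣ₀≋βSum k m))) ⟩
  Z ⊕ ((suc m × Z ⊕ O) ⊕ W)
    ≈⟨ ≋-trans (⊕-congʳ (⊕-assoc Z (suc m × Z) O)) (⊕-assoc Z (suc m × Z ⊕ O) W) ⟨
  harmonicFormula k (suc m) ∎
  where
  Z = sumZ (comps k (suc (suc m)))
  O = smul oneMinus2t ((k ∸ suc m) × sumZ (comps k (suc m)))
  W = smul t²-t (βSum k m)

harmonicSum≋harmonicFormula : ∀ m k → harmonicSum k m ≋ harmonicFormula k m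
harmonicSum≋harmonicFormula zero    = harmonicFormula-zero
harmonicSum≋harmonicFormula (suc m) = harmonicFormula-suc m (harmonicSum≋harmonicFormula m)

firstAtLeast2≡firstAbove1 : ∀ u → firstAtLeast2 u ≡ firstAbove 1 u
firstAtLeast2≡firstAbove1 []      = refl
firstAtLeast2≡firstAbove1 (_ ∷ _) = refl

b≡bᵣ1 : ∀ u → b u ≡ bᵣ 1 u
b≡bᵣ1 []      = refl
b≡bᵣ1 (_ ∷ _) = refl

secondIs1≡firstIs1 : ∀ l a w → 1 ≤ a → secondIs1 (l ∷ a ∷ w) ≡ firstIs1 (a ∷ w)
secondIs1≡firstIs1 l (suc zero)    w _ = refl
secondIs1≡firstIs1 l (suc (suc a)) w _ = refl

split-at-one : ∀ a w p → 1 ≤ a → p ≋ above 1 a × p ⊕ 𝟙 (firstIs1 (a ∷ w)) × p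
split-at-one (suc zero)    w p _ = ≋-sym (⊕-identityʳ p)
split-at-one (suc (suc a)) w p _ = ≋-sym (≋-trans (⊕-identityʳ _) (⊕-identityʳ p))

sumZ-comps0 : ∀ k j → sumZ (comps0 k j) ≋ Zᵣ 1 k j
sumZ-comps0 k j = ≋-trans (ΣL-filterB firstAtLeast2 (comps k j) (λ u → mono (zW u)))
  (ΣL-cong (comps k j) λ u → ≡⇒≋ (cong (λ p → 𝟙 p × mono (zW u)) (firstAtLeast2≡firstAbove1 u)))

bSum-comps0 : ∀ k j → hsum (map (λ u → qmul (fromℕ (b u)) (mono (zW u))) (comps0 k j)) ≋ Bᵣ 1 k j
bSum-comps0 k j = ≋-trans (ΣL-filterB firstAtLeast2 (comps k j) (λ u → qmul (fromℕ (b u)) (mono (zW u))))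
  (ΣL-cong (comps k j) λ u → ≋-trans (×-congʳ (𝟙 (firstAtLeast2 u)) (qmul-fromℕ (b u) (mono (zW u))))
    (≡⇒≋ (cong₂ (λ p n → 𝟙 p × (n × mono (zW u))) (firstAtLeast2≡firstAbove1 u) (b≡bᵣ1 u))))

sumZ-split-firstIs1 : ∀ k j → sumZ (comps k (suc j)) ≋ Zᵣ 1 k (suc j) ⊕ sumZ (filterB firstIs1 (comps k (suc j)))
sumZ-split-firstIs1 k j = begin
  sumZ (comps k (suc j))
    ≈⟨ ΣC-suc-cong k j (λ a w → split-at-one a w (mono (zW (a ∷ w)))) ⟩
  ΣL (comps k (suc j)) (λ u → 𝟙 (firstAbove 1 u) × mono (zW u) ⊕ 𝟙 (firstIs1 u) × mono (zW u))
    ≈⟨ ΣL-⊕ (comps k (suc j)) _ _ ⟩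
  Zᵣ 1 k (suc j) ⊕ ΣL (comps k (suc j)) (λ u → 𝟙 (firstIs1 u) × mono (zW u))
    ≈⟨ ⊕-congˡ (ΣL-filterB firstIs1 (comps k (suc j)) (λ u → mono (zW u))) ⟨
  Zᵣ 1 k (suc j) ⊕ sumZ (filterB firstIs1 (comps k (suc j))) ∎

LHS-tripleSum : ∀ k m → LHS k (suc (suc m)) ≋ tripleSum k m (λ l a w → above 1 a × ((l ∷ []) ∗t (a ∷ w)))
LHS-tripleSum k m = begin
  LHS k (suc (suc m))
    ≈⟨ hsum-concatMap (λ l → map (λ u → (l ∷ []) ∗t u) (comps0 (k ∸ l) (suc m))) (map suc (upTo k)) ⟩
  ΣL (map suc (upTo k)) (λ l → ΣL (comps0 (k ∸ l) (suc m)) (λ u → (l ∷ []) ∗t u))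
    ≈⟨ ΣL-upTo k _ ⟩
  σ k (λ l → ΣL (comps0 (k ∸ l) (suc m)) (λ u → (l ∷ []) ∗t u))
    ≈⟨ σ-cong′ k (λ l → ≋-trans (ΣL-filterB firstAtLeast2 (comps (k ∸ l) (suc m)) _) (ΣC-suc (k ∸ l) m _)) ⟩
  tripleSum k m (λ l a w → above 1 a × ((l ∷ []) ∗t (a ∷ w))) ∎

secondIs1-tripleSum : ∀ k m →
  sumZ (filterB secondIs1 (comps k (suc (suc m)))) ≋ tripleSum k m (λ l a w → 𝟙 (firstIs1 (a ∷ w)) × mono (zW (l ∷ a ∷ w)))
secondIs1-tripleSum k m = begin
  sumZ (filterB secondIs1 (comps k (suc (suc m))))
    ≈⟨ ΣL-filterB secondIs1 (comps k (suc (suc m))) (λ u → mono (zW u)) ⟩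
  ΣL (comps k (suc (suc m))) (λ u → 𝟙 (secondIs1 u) × mono (zW u))
    ≈⟨ ≋-trans (ΣC-suc k (suc m) _) (σ-cong′ k λ l → ΣC-suc (k ∸ l) m _) ⟩
  tripleSum k m (λ l a w → 𝟙 (secondIs1 (l ∷ a ∷ w)) × mono (zW (l ∷ a ∷ w)))
    ≈⟨ tripleSum-cong k m (λ l a w 1≤a → ≡⇒≋ (cong (λ p → 𝟙 p × mono (zW (l ∷ a ∷ w))) (secondIs1≡firstIs1 l a w 1≤a))) ⟩
  tripleSum k m (λ l a w → 𝟙 (firstIs1 (a ∷ w)) × mono (zW (l ∷ a ∷ w))) ∎

closedForm : ℕ → ℕ → H
closedForm k m = ((n × Zᵣ 1 k n ⊕ sumZ (filterB firstIs1 (comps k n))) ⊕ smul oneMinus2t ((k ∸ n) × Zᵣ 1 k (suc m)))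
                 ⊕ smul t²-t (Bᵣ 1 k m)
  where n = suc (suc m)

LHS-closedForm : ∀ k m → LHS k (suc (suc m)) ⊕ sumZ (filterB secondIs1 (comps k (suc (suc m)))) ≋ closedForm k m
LHS-closedForm k m = begin
  LHS k n ⊕ S
    ≈⟨ ⊕-congʳ (≋-trans (LHS-tripleSum k m) (restrictedSum-expansion 1 m (harmonicSum≋harmonicFormula m) k)) ⟩
  (T₁ ⊕ restrictedFormula 1 k m) ⊕ S
    ≈⟨ ≋-trans (⊕-assoc T₁ R S) (≋-trans (⊕-cong (≋-refl {T₁}) (⊕-comm R S)) (≋-sym (⊕-assoc T₁ S R))) ⟩
  (T₁ ⊕ S) ⊕ restrictedFormula 1 k m
    ≈⟨ ⊕-congʳ (≋-trans (⊕-cong (≋-refl {T₁}) (secondIs1-tripleSum k m))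
                 (≋-trans (≋-sym (tripleSum-⊕ k m _ _))
                   (≋-trans (tripleSum-cong k m λ l a w 1≤a → ≋-sym (split-at-one a w (mono (zW (l ∷ a ∷ w))) 1≤a))
                     (≋-trans (≋-sym (sumZ-tripleSum k m)) (sumZ-split-firstIs1 k (suc m)))))) ⟩
  (Z ⊕ F) ⊕ ((suc m × Z ⊕ smul oneMinus2t ((k ∸ (m ℕ.+ 2)) × Z′)) ⊕ W)
    ≈⟨ ⊕-cong (≋-refl {Z ⊕ F})
         (⊕-cong (⊕-cong (≋-refl {suc m × Z}) (≡⇒≋ (cong (λ i → smul oneMinus2t ((k ∸ i) × Z′)) (ℕ.+-comm m 2)))) (≋-refl {W})) ⟩
  (Z ⊕ F) ⊕ ((suc m × Z ⊕ O) ⊕ W)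
    ≈⟨ rearrange Z F (suc m × Z) O W ⟩
  closedForm k m ∎
  where
  n = suc (suc m)
  S = sumZ (filterB secondIs1 (comps k n))
  T₁ = tripleSum k m (λ l a w → above 1 a × mono (zW (l ∷ a ∷ w)))
  R = restrictedFormula 1 k m
  Z = Zᵣ 1 k n
  Z′ = Zᵣ 1 k (suc m)
  F = sumZ (filterB firstIs1 (comps k n))
  O = smul oneMinus2t ((k ∸ n) × Z′)
  W = smul t²-t (Bᵣ 1 k m)
  rearrange : ∀ z f p o w → (z ⊕ f) ⊕ ((p ⊕ o) ⊕ w) ≋ (((z ⊕ p) ⊕ f) ⊕ o) ⊕ w
  rearrange = solve 5 (λ z f p o w → (z ⊞ f) ⊞ ((p ⊞ o) ⊞ w) ⊜ (((z ⊞ p) ⊞ f) ⊞ o) ⊞ w) ≋-refl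
    where _⊞_ = ⊕-Solver._⊕_

RHS-closedForm : ∀ k m → RHS k (suc (suc m)) ⊕ sumZ (filterB secondIs1 (comps k (suc (suc m)))) ≋ closedForm k m
RHS-closedForm k m = begin
  ((((A ⊕ F) ⊖ S) ⊕ O) ⊕ W) ⊕ S   ≈⟨ rearrange ((A ⊕ F) ⊖ S) O W S ⟩
  ((((A ⊕ F) ⊖ S) ⊕ S) ⊕ O) ⊕ W   ≈⟨ ⊕-congʳ (⊕-congʳ (⊖-cancelʳ (A ⊕ F) S)) ⟩
  ((A ⊕ F) ⊕ O) ⊕ W
    ≈⟨ ⊕-cong (⊕-cong (⊕-congʳ (≋-trans (qmul-fromℕ n (sumZ (comps0 k n))) (×-congʳ n (sumZ-comps0 k n))))
                      (linear-cong (smul-isLinear oneMinus2t)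
                        (≋-trans (qmul-fromℕ (k ∸ n) (sumZ (comps0 k (suc m)))) (×-congʳ (k ∸ n) (sumZ-comps0 k (suc m))))))
              (linear-cong (smul-isLinear t²-t) (bSum-comps0 k m)) ⟩
  closedForm k m ∎
  where
  n = suc (suc m)
  A = qmul (fromℕ n) (sumZ (comps0 k n))
  F = sumZ (filterB firstIs1 (comps k n))
  S = sumZ (filterB secondIs1 (comps k n))
  O = smul oneMinus2t (qmul (fromℕ (k ∸ n)) (sumZ (comps0 k (suc m))))
  W = smul t²-t (hsum (map (λ ks → qmul (fromℕ (b ks)) (mono (zW ks))) (comps0 k m)))
  rearrange : ∀ d o w s → ((d ⊕ o) ⊕ w) ⊕ s ≋ ((d ⊕ s) ⊕ o) ⊕ w
  rearrange = solve 4 (λ d o w s → ((d ⊞ o) ⊞ w) ⊞ s ⊜ ((d ⊞ s) ⊞ o) ⊞ w) ≋-refl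
    where _⊞_ = ⊕-Solver._⊕_

mainTheorem14 : (k n : ℕ) → 2 ≤ n → n < k → LHS k n ≈ RHS k n
mainTheorem14 k (suc zero)    (s≤s ()) _
mainTheorem14 k (suc (suc m)) _ _ = coeff-≡ (⊕-cancelʳ (LHS k n) (RHS k n) (sumZ (filterB secondIs1 (comps k n)))
  (≋-trans (LHS-closedForm k m) (≋-sym (RHS-closedForm k m))))
  where n = suc (suc m)
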